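{- Let $k\geq 2$ be an integer and let $f_k(n)$ denote the number of $k$-front noncrossing partitions of $[n]$ (equivalently, $12\cdots k12$-avoiding partitions of $[n]$). Then $f_k(0)=f_k(1)=1$ and, for $n\geq 2$, $$f_k(n) = (k-1) f_k(n-1) + \sum_{i=1}^{k-3} (i+2-k) S(n-1,i) +\sum_{i=k-2}^{n-2} \left(f_k(i)-\sum_{j=1}^{k-3}S(i,j)\right) \cdot \sum_{r=1}^{k-1} s(k-1,r)\, f_k(n-2-i+r).$$
   Context: A partition of $[n]=\{1,\dots,n\}$ is a set of pairwise disjoint nonempty subsets (blocks) whose union is $[n]$; $[0]=\emptyset$ has exactly one partition. A head of a partition $\pi$ is the smallest element of a block. A front edge of $\pi$ is a pair $(i,j)$ with $i<j$, $i,j$ in the same block and $i$ the head of that block. For $k\ge2$, a $k$-front crossing of $\pi$ is a pair of front edges $(i_1,j_1),(i_2,j_2)$ with $i_1<i_2<j_1<j_2$ such that there are at least $k-2$ heads $h$ with $i_2<h<j_1$; $\pi$ is $k$-front noncrossing if it has no $k$-front crossing. (Equivalently, the canonical word $a_1\cdots a_n$ of $\pi$, where $a_i=j$ if $i$ lies in the $j$-th block when blocks are ordered by their minima, has no subsequence order-isomorphic to $12\cdots k12$.) $S(n,i)$ is the Stirling number of the second kind (number of partitions of $[n]$ into $i$ blocks), and $s(n,r)$ is the signed Stirling number of the first kind, i.e. $(-1)^{n-r}$ times the number of permutations of $[n]$ with $r$ cycles. Empty sums are $0$. -}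

module Defs where

open import Data.Nat as ℕ using (ℕ; zero; suc; _≤_; _∸_)
open import Data.Nat.Properties as ℕP using ()
open import Data.Integer as ℤ using (ℤ; +_; 0ℤ)
open import Data.Fin as F using (Fin)
open import Data.Fin.Properties as FP using (any?; all?)
open import Data.Vec as V using (Vec; []; _∷_; lookup)
open import Data.List as L using (List; []; _∷_; length; filter; map; concatMap; upTo; foldr; allFin)
open import Data.Product using (Σ; ∃; _×_; _,_)
open import Relation.Nullary using (¬_; Dec; yes; no)
open import Relation.Nullary.Decidable using (_×-dec_; ¬?; _→-dec_)
open import Relation.Binary.PropositionalEquality using (_≡_; _≢_)

-- A partition of [n] is encoded by a word w of length n: positions 0..n-1 stand
-- for the elements 1..n, and two elements lie in the same block iff they carry
-- the same letter.

IsHead : ∀ {n} → Vec ℕ n → Fin n → Set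
IsHead {n} w i = (j : Fin n) → j F.< i → lookup w j ≢ lookup w i

isHead? : ∀ {n} (w : Vec ℕ n) (i : Fin n) → Dec (IsHead w i)
isHead? w i = all? (λ j → (j F.<? i) →-dec ¬? (lookup w j ℕ.≟ lookup w i))

headsBetween : ∀ {n} → Vec ℕ n → Fin n → Fin n → ℕ
headsBetween {n} w a b =
  length (filter (λ h → (a F.<? h) ×-dec ((h F.<? b) ×-dec isHead? w h)) (allFin n))

headsBefore : ∀ {n} → Vec ℕ n → Fin n → ℕ
headsBefore {n} w a = length (filter (λ h → (h F.<? a) ×-dec isHead? w h) (allFin n))

-- Canonical word: the letter of every block is its index when blocks are
-- ordered by their minima (starting from 1).
Canonical : ∀ {n} → Vec ℕ n → Set
Canonical {n} w = (i : Fin n) → IsHead w i → lookup w i ≡ suc (headsBefore w i)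

canonical? : ∀ {n} (w : Vec ℕ n) → Dec (Canonical w)
canonical? w = all? (λ i → isHead? w i →-dec (lookup w i ℕ.≟ suc (headsBefore w i)))

FrontEdge : ∀ {n} → Vec ℕ n → Fin n → Fin n → Set
FrontEdge w i j = (i F.< j) × (lookup w i ≡ lookup w j) × IsHead w i

frontEdge? : ∀ {n} (w : Vec ℕ n) i j → Dec (FrontEdge w i j)
frontEdge? w i j = (i F.<? j) ×-dec ((lookup w i ℕ.≟ lookup w j) ×-dec isHead? w i)

CrossAt : ℕ → ∀ {n} → Vec ℕ n → Fin n → Fin n → Fin n → Fin n → Set
CrossAt k w i₁ i₂ j₁ j₂ =
  FrontEdge w i₁ j₁ × FrontEdge w i₂ j₂ × (i₁ F.< i₂) × (i₂ F.< j₁) × (j₁ F.< j₂)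
  × (k ∸ 2 ≤ headsBetween w i₂ j₁)

HasFrontCrossing : ℕ → ∀ {n} → Vec ℕ n → Set
HasFrontCrossing k w = ∃ λ i₁ → ∃ λ i₂ → ∃ λ j₁ → ∃ λ j₂ → CrossAt k w i₁ i₂ j₁ j₂

hasFrontCrossing? : ∀ k {n} (w : Vec ℕ n) → Dec (HasFrontCrossing k w)
hasFrontCrossing? k w =
  any? λ i₁ → any? λ i₂ → any? λ j₁ → any? λ j₂ →
    frontEdge? w i₁ j₁ ×-dec (frontEdge? w i₂ j₂ ×-dec ((i₁ F.<? i₂) ×-dec
    ((i₂ F.<? j₁) ×-dec ((j₁ F.<? j₂) ×-dec (k ∸ 2 ℕ.≤? headsBetween w i₂ j₁)))))

FrontNoncrossing : ℕ → ∀ {n} → Vec ℕ n → Set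
FrontNoncrossing k w = ¬ HasFrontCrossing k w

words : (m : ℕ) → List ℕ → List (Vec ℕ m)
words zero A = [] ∷ []
words (suc m) A = concatMap (λ a → map (a ∷_) (words m A)) A

oneTo : ℕ → List ℕ
oneTo n = map suc (upTo n)

-- canonical words of partitions of [n] (every such word has letters in 1..n)
-- that are k-front noncrossing; f k n is their number
f : ℕ → ℕ → ℕ
f k n = length (filter (λ w → canonical? w ×-dec ¬? (hasFrontCrossing? k w)) (words n (oneTo n)))

S : ℕ → ℕ → ℕ
S zero zero = 1
S zero (suc i) = 0
S (suc n) zero = 0
S (suc n) (suc i) = suc i ℕ.* S n (suc i) ℕ.+ S n i

s : ℕ → ℕ → ℤ
s zero zero = ℤ.+ 1
s zero (suc r) = 0ℤ
s (suc n) zero = 0ℤ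
s (suc n) (suc r) = s n r ℤ.- (+ n) ℤ.* s n (suc r)

-- Σ_{i=a}^{b} g i over integers (empty, i.e. 0, when b < a)
sumZ : ℕ → ℕ → (ℕ → ℤ) → ℤ
sumZ a b g = foldr (λ i acc → g i ℤ.+ acc) 0ℤ (map (a ℕ.+_) (upTo (suc b ∸ a)))

module Submission where

-- Let c = k - 2. Reading a canonical word from left to right, call a label closed when appending it
-- would complete a k-front crossing. Labels of the last c blocks are never closed, and appending an
-- open label b closes exactly the labels above b outside the last c blocks. Hence the number of
-- noncrossing completions of a prefix depends only on y = min(c, #blocks) and the number s of open
-- labels outside the last c blocks, and satisfies a transfer recursion W_{L+1} = R W_L with
-- W_0 = 1; then f_k(n) = W_n(0,0). The recurrence is algebra on R: by linearity
-- W_{L+1} = (c+1) W_L + R^L(s) - R^L(c - y); the second term is a Stirling sum, because from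
-- s = 0 only y moves until it reaches c; the first is a convolution of the walks reaching y = c
-- with W_t(c,1); and W_t(c,1) is E(E-1)⋯(E-c) applied to f_k, E the shift, whose coefficients
-- are the s(c+1,r).

module Transfer where

  open import Data.Nat
  open import Data.Nat.Properties
  open import Data.Nat.Tactic.RingSolver using (solve-∀)
  open import Data.Bool using (if_then_else_)
  open import Data.Empty using (⊥-elim)
  open import Data.Sum using (inj₁; inj₂)
  open import Function using (_∘_)
  open import Relation.Nullary using (¬_; yes; no)
  open import Relation.Binary.PropositionalEquality
  open import Defs using (S)

  sumTo : ℕ → (ℕ → ℕ) → ℕ
  sumTo zero    g = 0
  sumTo (suc s) g = sumTo s g + g (suc s)

  sumBelow : ℕ → (ℕ → ℕ) → ℕ
  sumBelow zero    g = 0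
  sumBelow (suc c) g = sumBelow c g + g c

  module _ {g h : ℕ → ℕ} where

    sumTo-cong : ∀ s → (∀ j → 1 ≤ j → j ≤ s → g j ≡ h j) → sumTo s g ≡ sumTo s h
    sumTo-cong zero    eq = refl
    sumTo-cong (suc s) eq =
      cong₂ _+_ (sumTo-cong s (λ j 1≤j j≤s → eq j 1≤j (m≤n⇒m≤1+n j≤s))) (eq (suc s) (s≤s z≤n) ≤-refl)

    sumTo-+ : ∀ s → sumTo s (λ j → g j + h j) ≡ sumTo s g + sumTo s h
    sumTo-+ zero    = refl
    sumTo-+ (suc s) rewrite sumTo-+ s = shuffle (sumTo s g) (sumTo s h) (g (suc s)) (h (suc s))
      where shuffle : ∀ a b x y → a + b + (x + y) ≡ a + x + (b + y)
            shuffle = solve-∀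

    sumBelow-cong : ∀ c → (∀ i → i < c → g i ≡ h i) → sumBelow c g ≡ sumBelow c h
    sumBelow-cong zero    eq = refl
    sumBelow-cong (suc c) eq = cong₂ _+_ (sumBelow-cong c (λ i i<c → eq i (m<n⇒m<1+n i<c))) (eq c ≤-refl)

    sumBelow-+ : ∀ c → sumBelow c (λ i → g i + h i) ≡ sumBelow c g + sumBelow c h
    sumBelow-+ zero    = refl
    sumBelow-+ (suc c) rewrite sumBelow-+ c = shuffle (sumBelow c g) (sumBelow c h) (g c) (h c)
      where shuffle : ∀ a b x y → a + b + (x + y) ≡ a + x + (b + y)
            shuffle = solve-∀

  sumTo-* : ∀ s a (g : ℕ → ℕ) → sumTo s (λ j → a * g j) ≡ a * sumTo s g
  sumTo-* zero    a g = sym (*-zeroʳ a)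
  sumTo-* (suc s) a g rewrite sumTo-* s a g = sym (*-distribˡ-+ a (sumTo s g) (g (suc s)))

  sumTo-const : ∀ s a → sumTo s (λ _ → a) ≡ s * a
  sumTo-const zero    a = refl
  sumTo-const (suc s) a rewrite sumTo-const s a = +-comm (s * a) a

  sumTo-zero : ∀ s (g : ℕ → ℕ) → (∀ j → 1 ≤ j → j ≤ s → g j ≡ 0) → sumTo s g ≡ 0
  sumTo-zero s g eq = trans (sumTo-cong s eq) (trans (sumTo-const s 0) (*-zeroʳ s))

  sumTo-shift : ∀ s (g : ℕ → ℕ) → sumTo s (g ∘ suc) + g 1 ≡ sumTo s g + g (suc s)
  sumTo-shift zero    g = refl
  sumTo-shift (suc s) g rewrite sym (sumTo-shift s g) = swap (sumTo s (g ∘ suc)) (g (suc (suc s))) (g 1)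
    where swap : ∀ a b x → a + b + x ≡ a + x + b
          swap = solve-∀

  sumTo-++ : ∀ a b (g : ℕ → ℕ) → sumTo (a + b) g ≡ sumTo a g + sumTo b (λ j → g (a + j))
  sumTo-++ a zero    g rewrite +-identityʳ a = sym (+-identityʳ _)
  sumTo-++ a (suc b) g rewrite +-suc a b | sumTo-++ a b g = +-assoc (sumTo a g) _ _

  sumBelow-* : ∀ c a (g : ℕ → ℕ) → sumBelow c (λ i → a * g i) ≡ a * sumBelow c g
  sumBelow-* zero    a g = sym (*-zeroʳ a)
  sumBelow-* (suc c) a g rewrite sumBelow-* c a g = sym (*-distribˡ-+ a (sumBelow c g) (g c))

  sumBelow-zero : ∀ c (g : ℕ → ℕ) → (∀ i → i < c → g i ≡ 0) → sumBelow c g ≡ 0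
  sumBelow-zero zero    g eq = refl
  sumBelow-zero (suc c) g eq =
    cong₂ _+_ (sumBelow-zero c g (λ i i<c → eq i (m<n⇒m<1+n i<c))) (eq c ≤-refl)

  sumBelow-suc : ∀ c (g : ℕ → ℕ) → sumBelow c (g ∘ suc) ≡ sumTo c g
  sumBelow-suc zero    g = refl
  sumBelow-suc (suc c) g = cong (_+ g (suc c)) (sumBelow-suc c g)

  δ : ℕ → ℕ → ℕ
  δ y i = if y ≡ᵇ i then 1 else 0

  δ-refl : ∀ y → δ y y ≡ 1
  δ-refl zero    = refl
  δ-refl (suc y) = δ-refl y

  δ-≢ : ∀ {y i} → y ≢ i → δ y i ≡ 0
  δ-≢ {zero}  {zero}  ne = ⊥-elim (ne refl)
  δ-≢ {zero}  {suc i} ne = refl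
  δ-≢ {suc y} {zero}  ne = refl
  δ-≢ {suc y} {suc i} ne = δ-≢ (ne ∘ cong suc)

  δ-* : ∀ y i → y * δ y i ≡ i * δ y i
  δ-* y i with y ≟ i
  ... | yes refl = refl
  ... | no  y≢i  rewrite δ-≢ y≢i = trans (*-zeroʳ y) (sym (*-zeroʳ i))

  sumBelow-δ : ∀ c y (g : ℕ → ℕ) → y < c → sumBelow c (λ i → δ y i * g i) ≡ g y
  sumBelow-δ (suc c) y g y<1+c with y ≟ c
  ... | yes refl rewrite δ-refl y | +-identityʳ (g y) =
    cong (_+ g y) (sumBelow-zero y _ (λ i i<y → cong (_* g i) (δ-≢ (λ y≡i → <-irrefl (sym y≡i) i<y))))
  ... | no y≢c rewrite δ-≢ y≢c | +-identityʳ (sumBelow c (λ i → δ y i * g i)) =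
    sumBelow-δ c y g (≤∧≢⇒< (s≤s⁻¹ y<1+c) y≢c)

  S-from : ℕ → ℕ → ℕ → ℕ
  S-from y zero    i = δ y i
  S-from y (suc L) i = y * S-from y L i + S-from (suc y) L i

  S-from-< : ∀ L {y i} → i < y → S-from y L i ≡ 0
  S-from-< zero    i<y = δ-≢ (λ y≡i → <-irrefl (sym y≡i) i<y)
  S-from-< (suc L) {y} i<y
    rewrite S-from-< L i<y | S-from-< L (m<n⇒m<1+n i<y) = trans (+-identityʳ _) (*-zeroʳ y)

  S-from-suc : ∀ L y i → S-from y (suc L) (suc i) ≡ suc i * S-from y L (suc i) + S-from y L i
  S-from-suc zero    y i = cong (_+ δ y i) (δ-* y (suc i))
  S-from-suc (suc L) y i =
    trans (cong₂ _+_ (cong (y *_) (S-from-suc L y i)) (S-from-suc L (suc y) i))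
          (regroup y (suc i) (S-from y L (suc i)) (S-from y L i) (S-from (suc y) L (suc i)) (S-from (suc y) L i))
    where regroup : ∀ y j a b u v → y * (j * a + b) + (j * u + v) ≡ j * (y * a + u) + (y * b + v)
          regroup = solve-∀

  S-from-zero : ∀ L i → S-from 0 L i ≡ S L i
  S-from-zero zero    zero    = refl
  S-from-zero zero    (suc i) = refl
  S-from-zero (suc L) zero    = S-from-< L (s≤s z≤n)
  S-from-zero (suc L) (suc i) rewrite S-from-suc L 0 i | S-from-zero L (suc i) | S-from-zero L i = refl

  conv : (ℕ → ℕ) → (ℕ → ℕ) → ℕ → ℕ
  conv A B zero    = 0
  conv A B (suc L) = A 0 * B L + conv (A ∘ suc) B L

  -- A state (y , s) of a word with c = k - 2: y = min(c, #blocks) counts the labels of the last c blocks,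
  -- which are never closed, and s the labels below them that are still open. The three terms of step
  -- append a young label, the j-th open old label (which leaves j open), or a new block.
  StateFun : Set
  StateFun = ℕ → ℕ → ℕ

  module _ (c : ℕ) where

    Agree : StateFun → StateFun → Set
    Agree F G = ∀ y s → y ≤ c → F y s ≡ G y s

    newBlock : StateFun → StateFun
    newBlock F y s with y <? c
    ... | yes _ = F (suc y) s
    ... | no  _ = F y (suc s)

    step : StateFun → StateFun
    step F y s = y * F y s + sumTo s (F y) + newBlock F y s

    steps : ℕ → StateFun → StateFun
    steps zero    φ = φ
    steps (suc L) φ = step (steps L φ)

    walks : ℕ → StateFun
    walks L = steps L (λ _ _ → 1)

    newBlock-< : ∀ F {y} s → y < c → newBlock F y s ≡ F (suc y) s
    newBlock-< F {y} s y<c with y <? c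
    ... | yes _   = refl
    ... | no  y≮c = ⊥-elim (y≮c y<c)

    newBlock-≮ : ∀ F {y} s → ¬ y < c → newBlock F y s ≡ F y (suc s)
    newBlock-≮ F {y} s y≮c with y <? c
    ... | yes y<c = ⊥-elim (y≮c y<c)
    ... | no  _   = refl

    newBlock-const : ∀ a y s → newBlock (λ _ _ → a) y s ≡ a
    newBlock-const a y s with y <? c
    ... | yes _ = refl
    ... | no  _ = refl

    newBlock-+ : ∀ F G y s → newBlock (λ a b → F a b + G a b) y s ≡ newBlock F y s + newBlock G y s
    newBlock-+ F G y s with y <? c
    ... | yes _ = refl
    ... | no  _ = refl

    newBlock-* : ∀ k F y s → newBlock (λ a b → k * F a b) y s ≡ k * newBlock F y s
    newBlock-* k F y s with y <? c
    ... | yes _ = refl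
    ... | no  _ = refl

    newBlock-cong : ∀ {F G} → Agree F G → Agree (newBlock F) (newBlock G)
    newBlock-cong F≈G y s y≤c with y <? c
    ... | yes y<c = F≈G (suc y) s y<c
    ... | no  _   = F≈G y (suc s) y≤c

    step-cong : ∀ {F G} → Agree F G → Agree (step F) (step G)
    step-cong F≈G y s y≤c =
      cong₂ _+_ (cong₂ _+_ (cong (y *_) (F≈G y s y≤c)) (sumTo-cong s (λ j _ _ → F≈G y j y≤c)))
                (newBlock-cong F≈G y s y≤c)

    step-+ : ∀ F G y s → step (λ a b → F a b + G a b) y s ≡ step F y s + step G y s
    step-+ F G y s rewrite newBlock-+ F G y s | sumTo-+ {F y} {G y} s =
      regroup y (F y s) (G y s) (sumTo s (F y)) (sumTo s (G y)) (newBlock F y s) (newBlock G y s)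
      where regroup : ∀ y a b p q u v → y * (a + b) + (p + q) + (u + v) ≡ y * a + p + u + (y * b + q + v)
            regroup = solve-∀

    step-* : ∀ k F y s → step (λ a b → k * F a b) y s ≡ k * step F y s
    step-* k F y s rewrite newBlock-* k F y s | sumTo-* s k (F y) =
      regroup y k (F y s) (sumTo s (F y)) (newBlock F y s)
      where regroup : ∀ y k a p u → y * (k * a) + k * p + k * u ≡ k * (y * a + p + u)
            regroup = solve-∀

    step-zero : ∀ y s → step (λ _ _ → 0) y s ≡ 0
    step-zero y s rewrite newBlock-const 0 y s | *-zeroʳ y | sumTo-const s 0 | *-zeroʳ s = refl

    steps-cong : ∀ {φ ψ} L → Agree φ ψ → Agree (steps L φ) (steps L ψ)
    steps-cong zero    φ≈ψ = φ≈ψ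
    steps-cong (suc L) φ≈ψ = step-cong (steps-cong L φ≈ψ)

    steps-+ : ∀ φ ψ L → Agree (steps L (λ a b → φ a b + ψ a b)) (λ a b → steps L φ a b + steps L ψ a b)
    steps-+ φ ψ zero    y s _   = refl
    steps-+ φ ψ (suc L) y s y≤c =
      trans (step-cong (steps-+ φ ψ L) y s y≤c) (step-+ (steps L φ) (steps L ψ) y s)

    deficit : StateFun
    deficit y _ = c ∸ y

    sCoord : StateFun
    sCoord _ s = s

    -- step applied to the constant 1 is y + s + 1 = (c + 1) + s - (c - y); the rest is linearity.
    walks-suc : ∀ L y s → y ≤ c →
      walks (suc L) y s + steps L deficit y s ≡ suc c * walks L y s + steps L sCoord y s
    walks-suc zero y s y≤c
      rewrite newBlock-const 1 y s | sumTo-const s 1 | *-identityʳ y | *-identityʳ s | *-identityʳ c =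
      begin
        y + s + 1 + (c ∸ y) ≡⟨ regroup y s (c ∸ y) ⟩
        c ∸ y + y + suc s   ≡⟨ cong (_+ suc s) (m∸n+n≡m y≤c) ⟩
        c + suc s           ≡⟨ +-suc c s ⟩
        suc (c + s)         ∎
      where open ≡-Reasoning
            regroup : ∀ y s d → y + s + 1 + d ≡ d + y + suc s
            regroup = solve-∀
    walks-suc (suc L) y s y≤c =
      begin
        step (walks (suc L)) y s + step (steps L deficit) y s
      ≡⟨ sym (step-+ (walks (suc L)) (steps L deficit) y s) ⟩
        step (λ a b → walks (suc L) a b + steps L deficit a b) y s
      ≡⟨ step-cong (walks-suc L) y s y≤c ⟩
        step (λ a b → suc c * walks L a b + steps L sCoord a b) y s
      ≡⟨ step-+ (λ a b → suc c * walks L a b) (steps L sCoord) y s ⟩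
        step (λ a b → suc c * walks L a b) y s + step (steps L sCoord) y s
      ≡⟨ cong (_+ step (steps L sCoord) y s) (step-* (suc c) (walks L) y s) ⟩
        suc c * step (walks L) y s + step (steps L sCoord) y s
      ∎
      where open ≡-Reasoning

    yOnly : (ℕ → ℕ) → StateFun
    yOnly ψ y _ = ψ y

    steps-yOnly-at-c : ∀ ψ → ψ c ≡ 0 → ∀ L s → steps L (yOnly ψ) c s ≡ 0
    steps-yOnly-at-c ψ ψc≡0 zero    s = ψc≡0
    steps-yOnly-at-c ψ ψc≡0 (suc L) s =
      cong₂ _+_ (cong₂ _+_ (trans (cong (c *_) (IH s)) (*-zeroʳ c)) (sumTo-zero s _ (λ j _ _ → IH j)))
                (trans (newBlock-≮ (steps L (yOnly ψ)) s (<-irrefl refl)) (IH (suc s)))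
      where IH = steps-yOnly-at-c ψ ψc≡0 L

    -- From s = 0 the walk keeps s = 0 until y reaches c, and moves y exactly as the recurrence of S.
    steps-yOnly-from : ∀ ψ → ψ c ≡ 0 → ∀ L y → y ≤ c →
      steps L (yOnly ψ) y 0 ≡ sumBelow c (λ i → S-from y L i * ψ i)
    steps-yOnly-from ψ ψc≡0 L y y≤c with y <? c
    steps-yOnly-from ψ ψc≡0 zero y y≤c | yes y<c = sym (sumBelow-δ c y ψ y<c)
    steps-yOnly-from ψ ψc≡0 (suc L) y y≤c | yes y<c
      rewrite newBlock-< (steps L (yOnly ψ)) 0 y<c
            | steps-yOnly-from ψ ψc≡0 L y y≤c | steps-yOnly-from ψ ψc≡0 L (suc y) y<c =
      begin
        y * sumBelow c (λ i → T y i * ψ i) + 0 + sumBelow c (λ i → T (suc y) i * ψ i)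
      ≡⟨ cong (_+ sumBelow c (λ i → T (suc y) i * ψ i)) (+-identityʳ _) ⟩
        y * sumBelow c (λ i → T y i * ψ i) + sumBelow c (λ i → T (suc y) i * ψ i)
      ≡⟨ cong (_+ sumBelow c (λ i → T (suc y) i * ψ i)) (sym (sumBelow-* c y (λ i → T y i * ψ i))) ⟩
        sumBelow c (λ i → y * (T y i * ψ i)) + sumBelow c (λ i → T (suc y) i * ψ i)
      ≡⟨ sym (sumBelow-+ c) ⟩
        sumBelow c (λ i → y * (T y i * ψ i) + T (suc y) i * ψ i)
      ≡⟨ sumBelow-cong c (λ i _ → factor y (T y i) (ψ i) (T (suc y) i)) ⟩
        sumBelow c (λ i → (y * T y i + T (suc y) i) * ψ i)
      ∎
      where open ≡-Reasoning
            T : ℕ → ℕ → ℕ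
            T y = S-from y L
            factor : ∀ y a p b → y * (a * p) + b * p ≡ (y * a + b) * p
            factor = solve-∀
    steps-yOnly-from ψ ψc≡0 L y y≤c | no y≮c with ≤-antisym y≤c (≮⇒≥ y≮c)
    ... | refl = trans (steps-yOnly-at-c ψ ψc≡0 L 0)
                       (sym (sumBelow-zero y _ (λ i i<y → cong (_* ψ i) (S-from-< L i<y))))

    steps-yOnly : ∀ ψ → ψ c ≡ 0 → ∀ L → steps L (yOnly ψ) 0 0 ≡ sumBelow c (λ i → S L i * ψ i)
    steps-yOnly ψ ψc≡0 L =
      trans (steps-yOnly-from ψ ψc≡0 L 0 z≤n) (sumBelow-cong c (λ i _ → cong (_* ψ i) (S-from-zero L i)))

    saturated : StateFun
    saturated y _ with y <? c
    ... | yes _ = 0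
    ... | no  _ = 1

    unsaturated : ℕ → ℕ
    unsaturated y with y <? c
    ... | yes _ = 1
    ... | no  _ = 0

    saturated-< : ∀ {y} s → y < c → saturated y s ≡ 0
    saturated-< {y} s y<c with y <? c
    ... | yes _   = refl
    ... | no  y≮c = ⊥-elim (y≮c y<c)

    saturated-c : ∀ s → saturated c s ≡ 1
    saturated-c s with c <? c
    ... | yes c<c = ⊥-elim (<-irrefl refl c<c)
    ... | no  _   = refl

    unsaturated-c : unsaturated c ≡ 0
    unsaturated-c with c <? c
    ... | yes c<c = ⊥-elim (<-irrefl refl c<c)
    ... | no  _   = refl

    partialSums : StateFun → StateFun
    partialSums F y s = sumTo s (F y)

    newBlock-partialSums : ∀ F y s → y ≤ c →
      newBlock (partialSums F) y s ≡ partialSums (newBlock F) y s + saturated y s * F c 1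
    newBlock-partialSums F y s y≤c with m≤n⇒m<n∨m≡n y≤c
    ... | inj₁ y<c rewrite newBlock-< (partialSums F) s y<c | saturated-< s y<c =
      trans (sumTo-cong s (λ q _ _ → sym (newBlock-< F q y<c))) (sym (+-identityʳ _))
    ... | inj₂ refl rewrite newBlock-≮ (partialSums F) s (<-irrefl refl) | saturated-c s | +-identityʳ (F y 1) =
      sym (trans (cong (_+ F y 1) (sumTo-cong s (λ q _ _ → newBlock-≮ F q (<-irrefl refl)))) (sumTo-shift s (F y)))

    step-partialSums : ∀ F y s → y ≤ c →
      step (partialSums F) y s ≡ partialSums (step F) y s + saturated y s * F c 1
    step-partialSums F y s y≤c =
      begin
        y * sumTo s (F y) + sumTo s (partialSums F y) + newBlock (partialSums F) y s
      ≡⟨ cong (y * sumTo s (F y) + sumTo s (partialSums F y) +_) (newBlock-partialSums F y s y≤c) ⟩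
        y * sumTo s (F y) + sumTo s (partialSums F y) + (N + B)
      ≡⟨ sym (+-assoc _ N B) ⟩
        y * sumTo s (F y) + sumTo s (partialSums F y) + N + B
      ≡⟨ cong (λ z → z + sumTo s (partialSums F y) + N + B) (sym (sumTo-* s y (F y))) ⟩
        sumTo s (λ q → y * F y q) + sumTo s (partialSums F y) + N + B
      ≡⟨ cong (λ z → z + N + B) (sym (sumTo-+ s)) ⟩
        sumTo s (λ q → y * F y q + sumTo q (F y)) + N + B
      ≡⟨ cong (_+ B) (sym (sumTo-+ s)) ⟩
        sumTo s (step F y) + B
      ∎
      where open ≡-Reasoning
            N = partialSums (newBlock F) y s
            B = saturated y s * F c 1

    conv-step : ∀ L (F : ℕ → StateFun) B →
      Agree (λ y s → conv (λ i → step (F i) y s) B L) (step (λ y s → conv (λ i → F i y s) B L))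
    conv-step zero    F B y s _   = sym (step-zero y s)
    conv-step (suc L) F B y s y≤c =
      begin
        step (F 0) y s * B L + conv (λ i → step (F (suc i)) y s) B L
      ≡⟨ cong₂ _+_ (*-comm _ (B L)) (conv-step L (F ∘ suc) B y s y≤c) ⟩
        B L * step (F 0) y s + step (λ a b → conv (λ i → F (suc i) a b) B L) y s
      ≡⟨ cong (_+ step (λ a b → conv (λ i → F (suc i) a b) B L) y s) (sym (step-* (B L) (F 0) y s)) ⟩
        step (λ a b → B L * F 0 a b) y s + step (λ a b → conv (λ i → F (suc i) a b) B L) y s
      ≡⟨ sym (step-+ _ _ y s) ⟩
        step (λ a b → B L * F 0 a b + conv (λ i → F (suc i) a b) B L) y s
      ≡⟨ step-cong (λ a b _ → cong (_+ conv (λ i → F (suc i) a b) B L) (*-comm (B L) (F 0 a b))) y s y≤c ⟩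
        step (λ a b → F 0 a b * B L + conv (λ i → F (suc i) a b) B L) y s
      ∎
      where open ≡-Reasoning

    steps-sCoord : ∀ L y s → y ≤ c →
      steps L sCoord y s ≡ sumTo s (walks L y) + conv (λ i → steps i saturated y s) (λ t → walks t c 1) L
    steps-sCoord zero    y s _   = trans (sym (trans (sumTo-const s 1) (*-identityʳ s))) (sym (+-identityʳ _))
    steps-sCoord (suc L) y s y≤c =
      begin
        step (steps L sCoord) y s
      ≡⟨ step-cong (steps-sCoord L) y s y≤c ⟩
        step (λ a b → partialSums (walks L) a b + Z a b) y s
      ≡⟨ step-+ (partialSums (walks L)) Z y s ⟩
        step (partialSums (walks L)) y s + step Z y s
      ≡⟨ cong₂ _+_ (step-partialSums (walks L) y s y≤c) (sym (conv-step L (λ i → steps i saturated) B y s y≤c)) ⟩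
        sumTo s (walks (suc L) y) + saturated y s * walks L c 1 + conv (λ i → steps (suc i) saturated y s) B L
      ≡⟨ +-assoc (sumTo s (walks (suc L) y)) (saturated y s * walks L c 1) _ ⟩
        sumTo s (walks (suc L) y) + (saturated y s * walks L c 1 + conv (λ i → steps (suc i) saturated y s) B L)
      ∎
      where open ≡-Reasoning
            B : ℕ → ℕ
            B t = walks t c 1
            Z : StateFun
            Z a b = conv (λ i → steps i saturated a b) B L

    steps-saturated-early : ∀ i y → y + i < c → steps i saturated y 0 ≡ 0
    steps-saturated-early zero    y y+0<c = saturated-< 0 (subst (_< c) (+-identityʳ y) y+0<c)
    steps-saturated-early (suc i) y y+i<c =
      cong₂ _+_ (cong (_+ 0) (trans (cong (y *_) (steps-saturated-early i y y+i<c′)) (*-zeroʳ y)))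
                (trans (newBlock-< (steps i saturated) 0 y<c) (steps-saturated-early i (suc y) (subst (_< c) (+-suc y i) y+i<c)))
      where y<c : y < c
            y<c = ≤-trans (s≤s (m≤m+n y (suc i))) y+i<c
            y+i<c′ : y + i < c
            y+i<c′ = ≤-trans (s≤s (+-monoʳ-≤ y (n≤1+n i))) y+i<c

    steps-saturated+unsaturated : ∀ L → steps L saturated 0 0 + steps L (yOnly unsaturated) 0 0 ≡ walks L 0 0
    steps-saturated+unsaturated L =
      trans (sym (steps-+ saturated (yOnly unsaturated) L 0 0 z≤n)) (steps-cong L partition 0 0 z≤n)
      where partition : Agree (λ y s → saturated y s + yOnly unsaturated y s) (λ _ _ → 1)
            partition y s _ with y <? c
            ... | yes _ = refl
            ... | no  _ = refl

    walks-suc-< : ∀ t a → a < c → walks (suc t) a 0 ≡ a * walks t a 0 + walks t (suc a) 0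
    walks-suc-< t a a<c = cong₂ _+_ (+-identityʳ _) (newBlock-< (walks t) 0 a<c)

    walks-suc-c : ∀ t → walks (suc t) c 0 ≡ c * walks t c 0 + walks t c 1
    walks-suc-c t = cong₂ _+_ (+-identityʳ _) (newBlock-≮ (walks t) 0 (<-irrefl refl))

module Differences where

  open import Data.Nat as ℕ using (ℕ; zero; suc; _+_; _∸_; _≤_; _<_; z≤n; s≤s)
  import Data.Nat.Properties as ℕ
  open import Data.Integer using (ℤ; +_; -_; _-_; 0ℤ; _*_) renaming (_+_ to _⊕_)
  import Data.Integer.Properties as ℤ
  open import Data.Integer.Tactic.RingSolver using (solve-∀)
  open import Data.List using (map; foldr; applyUpTo)
  open import Data.Empty using (⊥-elim)
  open import Function using (_∘_)
  open import Relation.Nullary using (Dec; yes; no)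
  open import Relation.Binary.PropositionalEquality
  open import Defs using (sumZ; s; S)

  sumFrom : ℕ → ℕ → (ℕ → ℤ) → ℤ
  sumFrom a zero    g = 0ℤ
  sumFrom a (suc t) g = g a ⊕ sumFrom (suc a) t g

  sumZ≡sumFrom : ∀ a b g → sumZ a b g ≡ sumFrom a (suc b ∸ a) g
  sumZ≡sumFrom a b g = go (λ i → a + i) (λ i → i) a (suc b ∸ a) (λ i → refl)
    where
      go : ∀ (m h : ℕ → ℕ) a t → (∀ i → m (h i) ≡ a + i) →
           foldr (λ i acc → g i ⊕ acc) 0ℤ (map m (applyUpTo h t)) ≡ sumFrom a t g
      go m h a zero    eq = refl
      go m h a (suc t) eq =
        cong₂ _⊕_ (cong g (trans (eq 0) (ℕ.+-identityʳ a)))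
                  (go m (h ∘ suc) (suc a) t (λ i → trans (eq (suc i)) (ℕ.+-suc a i)))

  sumFrom-cong : ∀ a t {g h : ℕ → ℤ} → (∀ i → a ≤ i → i < a + t → g i ≡ h i) → sumFrom a t g ≡ sumFrom a t h
  sumFrom-cong a zero    eq = refl
  sumFrom-cong a (suc t) eq =
    cong₂ _⊕_ (eq a ℕ.≤-refl (ℕ.m<m+n a (s≤s z≤n)))
              (sumFrom-cong (suc a) t (λ i a<i i< → eq i (ℕ.<⇒≤ a<i) (subst (i <_) (sym (ℕ.+-suc a t)) i<)))

  sumFrom-⊕ : ∀ a t (g h : ℕ → ℤ) → sumFrom a t (λ i → g i ⊕ h i) ≡ sumFrom a t g ⊕ sumFrom a t h
  sumFrom-⊕ a zero    g h = refl
  sumFrom-⊕ a (suc t) g h rewrite sumFrom-⊕ (suc a) t g h =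
    shuffle (g a) (h a) (sumFrom (suc a) t g) (sumFrom (suc a) t h)
    where shuffle : ∀ x y u v → x ⊕ y ⊕ (u ⊕ v) ≡ x ⊕ u ⊕ (y ⊕ v)
          shuffle = solve-∀

  sumFrom-* : ∀ a t k (g : ℕ → ℤ) → sumFrom a t (λ i → k * g i) ≡ k * sumFrom a t g
  sumFrom-* a zero    k g = sym (ℤ.*-zeroʳ k)
  sumFrom-* a (suc t) k g rewrite sumFrom-* (suc a) t k g = sym (ℤ.*-distribˡ-+ k (g a) _)

  sumFrom-neg : ∀ a t (g : ℕ → ℤ) → sumFrom a t (λ i → - g i) ≡ - sumFrom a t g
  sumFrom-neg a zero    g = refl
  sumFrom-neg a (suc t) g rewrite sumFrom-neg (suc a) t g = sym (ℤ.neg-distrib-+ (g a) _)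

  sumFrom-zero : ∀ a t (g : ℕ → ℤ) → (∀ i → a ≤ i → i < a + t → g i ≡ 0ℤ) → sumFrom a t g ≡ 0ℤ
  sumFrom-zero a zero    g eq = refl
  sumFrom-zero a (suc t) g eq = cong₂ _⊕_ (eq a ℕ.≤-refl (ℕ.m<m+n a (s≤s z≤n))) (sumFrom-zero (suc a) t g eq′)
    where eq′ : ∀ i → suc a ≤ i → i < suc a + t → g i ≡ 0ℤ
          eq′ i a<i i< = eq i (ℕ.<⇒≤ a<i) (subst (i <_) (sym (ℕ.+-suc a t)) i<)

  sumFrom-shift : ∀ a t (g : ℕ → ℤ) → sumFrom (suc a) t g ≡ sumFrom a t (g ∘ suc)
  sumFrom-shift a zero    g = refl
  sumFrom-shift a (suc t) g = cong (g (suc a) ⊕_) (sumFrom-shift (suc a) t g)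

  sumFrom-last : ∀ a t (g : ℕ → ℤ) → sumFrom a (suc t) g ≡ sumFrom a t g ⊕ g (a + t)
  sumFrom-last a zero    g rewrite ℕ.+-identityʳ a = trans (ℤ.+-identityʳ (g a)) (sym (ℤ.+-identityˡ (g a)))
  sumFrom-last a (suc t) g rewrite sumFrom-last (suc a) t g | ℕ.+-suc a t = sym (ℤ.+-assoc (g a) _ _)

  sumFrom-++ : ∀ a t u (g : ℕ → ℤ) → sumFrom a (t + u) g ≡ sumFrom a t g ⊕ sumFrom (a + t) u g
  sumFrom-++ a zero    u g rewrite ℕ.+-identityʳ a = sym (ℤ.+-identityˡ _)
  sumFrom-++ a (suc t) u g rewrite sumFrom-++ (suc a) t u g | ℕ.+-suc a t = sym (ℤ.+-assoc (g a) _ _)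

  s-vanishes : ∀ a r → a < r → s a r ≡ 0ℤ
  s-vanishes zero    (suc r) _ = refl
  s-vanishes (suc a) (suc r) (s≤s a<r)
    rewrite s-vanishes a r a<r | s-vanishes a (suc r) (ℕ.m<n⇒m<1+n a<r) | ℤ.*-zeroʳ (+ a) = refl

  -- Since Σ_r s(a,r) xʳ = x(x-1)⋯(x-a+1), fallingShift a applies E(E-1)⋯(E-a+1) for the shift E;
  -- fallingShift-suc is this factorisation.
  fallingShift : ℕ → (ℕ → ℤ) → ℕ → ℤ
  fallingShift a F t = sumFrom 0 (suc a) (λ r → s a r * F (t + r))

  fallingShift-reindex : ∀ a (F : ℕ → ℤ) t →
    + a * sumFrom 0 (suc a) (λ r → s a (suc r) * F (t + suc r)) ≡ + a * fallingShift a F t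
  fallingShift-reindex zero    F t = refl
  fallingShift-reindex (suc a) F t = cong (+ suc a *_) (begin
      sumFrom 0 (suc (suc a)) (h ∘ suc)
    ≡⟨ sym (sumFrom-shift 0 (suc (suc a)) h) ⟩
      sumFrom 1 (suc (suc a)) h
    ≡⟨ sumFrom-last 1 (suc a) h ⟩
      sumFrom 1 (suc a) h ⊕ s (suc a) (suc (suc a)) * F (t + suc (suc a))
    ≡⟨ cong (λ x → sumFrom 1 (suc a) h ⊕ x * F (t + suc (suc a))) (s-vanishes (suc a) (suc (suc a)) ℕ.≤-refl) ⟩
      sumFrom 1 (suc a) h ⊕ 0ℤ * F (t + suc (suc a))
    ≡⟨ dropZero (sumFrom 1 (suc a) h) (F (t + suc (suc a))) (F (t + 0)) ⟩
      0ℤ * F (t + 0) ⊕ sumFrom 1 (suc a) h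
    ∎)
    where open ≡-Reasoning
          h : ℕ → ℤ
          h r = s (suc a) r * F (t + r)
          dropZero : ∀ x y z → x ⊕ 0ℤ * y ≡ 0ℤ * z ⊕ x
          dropZero = solve-∀

  fallingShift-suc : ∀ a (F : ℕ → ℤ) t →
    fallingShift (suc a) F t ≡ fallingShift a F (suc t) - + a * fallingShift a F t
  fallingShift-suc a F t = begin
      0ℤ * F (t + 0) ⊕ sumFrom 1 (suc a) g
    ≡⟨ cong (_⊕ sumFrom 1 (suc a) g) (ℤ.*-zeroˡ (F (t + 0))) ⟩
      0ℤ ⊕ sumFrom 1 (suc a) g
    ≡⟨ ℤ.+-identityˡ _ ⟩
      sumFrom 1 (suc a) g
    ≡⟨ sumFrom-shift 0 (suc a) g ⟩
      sumFrom 0 (suc a) (g ∘ suc)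
    ≡⟨ sumFrom-cong 0 (suc a) (λ r _ _ → stirlingStep r) ⟩
      sumFrom 0 (suc a) (λ r → s a r * F (suc t + r) ⊕ - (+ a * G r))
    ≡⟨ sumFrom-⊕ 0 (suc a) (λ r → s a r * F (suc t + r)) (λ r → - (+ a * G r)) ⟩
      fallingShift a F (suc t) ⊕ sumFrom 0 (suc a) (λ r → - (+ a * G r))
    ≡⟨ cong (fallingShift a F (suc t) ⊕_) (trans (sumFrom-neg 0 (suc a) (λ r → + a * G r)) (cong -_ (sumFrom-* 0 (suc a) (+ a) G))) ⟩
      fallingShift a F (suc t) - + a * sumFrom 0 (suc a) G
    ≡⟨ cong (λ x → fallingShift a F (suc t) - x) (fallingShift-reindex a F t) ⟩
      fallingShift a F (suc t) - + a * fallingShift a F t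
    ∎
    where open ≡-Reasoning
          g : ℕ → ℤ
          g r = s (suc a) r * F (t + r)
          G : ℕ → ℤ
          G r = s a (suc r) * F (t + suc r)
          distrib : ∀ x y k z → (x - k * y) * z ≡ x * z ⊕ - (k * (y * z))
          distrib = solve-∀
          stirlingStep : ∀ r → g (suc r) ≡ s a r * F (suc t + r) ⊕ - (+ a * G r)
          stirlingStep r rewrite ℕ.+-suc t r = distrib (s a r) (s a (suc r)) (+ a) (F (suc (t + r)))

  module _ (c : ℕ) where
    open Transfer using (walks; walks-suc-<; walks-suc-c)

    private
      cancel : ∀ a x y → + (a ℕ.* x + y) - + a * + x ≡ + y
      cancel a x y = trans (cong (λ u → u - + a * + x) (trans (ℤ.pos-+ (a ℕ.* x) y) (cong (_⊕ + y) (ℤ.pos-* a x))))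
                           (ring (+ a) (+ x) (+ y))
        where ring : ∀ a x y → a * x ⊕ y - a * x ≡ y
              ring = solve-∀

    fallingShift-walks : ∀ a t → a ≤ c → fallingShift a (λ t → + walks c t 0 0) t ≡ + walks c t a 0
    fallingShift-walks zero    t _ rewrite ℕ.+-identityʳ t = trans (ℤ.+-identityʳ _) (ℤ.*-identityˡ _)
    fallingShift-walks (suc a) t a<c
      rewrite fallingShift-suc a (λ t → + walks c t 0 0) t
            | fallingShift-walks a (suc t) (ℕ.<⇒≤ a<c) | fallingShift-walks a t (ℕ.<⇒≤ a<c)
            | walks-suc-< c t a a<c = cancel a (walks c t a 0) (walks c t (suc a) 0)

    fallingShift-walks-c1 : ∀ t → fallingShift (suc c) (λ t → + walks c t 0 0) t ≡ + walks c t c 1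
    fallingShift-walks-c1 t
      rewrite fallingShift-suc c (λ t → + walks c t 0 0) t
            | fallingShift-walks c (suc t) ℕ.≤-refl | fallingShift-walks c t ℕ.≤-refl
            | walks-suc-c c t = cancel c (walks c t c 0) (walks c t c 1)

  sumBelow≡sumFrom : ∀ c h → + Transfer.sumBelow c h ≡ sumFrom 0 c (λ i → + h i)
  sumBelow≡sumFrom zero    h = refl
  sumBelow≡sumFrom (suc c) h =
    trans (ℤ.pos-+ (Transfer.sumBelow c h) (h c))
          (trans (cong (_⊕ + h c) (sumBelow≡sumFrom c h)) (sym (sumFrom-last 0 c (λ i → + h i))))

  conv≡sumFrom : ∀ L (A B : ℕ → ℕ) → + Transfer.conv A B L ≡ sumFrom 0 L (λ i → + A i * + B (L ∸ suc i))
  conv≡sumFrom zero    A B = refl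
  conv≡sumFrom (suc L) A B =
    trans (ℤ.pos-+ (A 0 ℕ.* B L) (Transfer.conv (A ∘ suc) B L))
          (cong₂ _⊕_ (ℤ.pos-* (A 0) (B L))
                     (trans (conv≡sumFrom L (A ∘ suc) B) (sym (sumFrom-shift 0 L (λ i → + A i * + B (suc L ∸ suc i))))))

  sumBelow-S≡sumZ : ∀ c i → c ≤ i → + Transfer.sumBelow c (S i) ≡ sumZ 1 (c ∸ 1) (λ j → + S i j)
  sumBelow-S≡sumZ zero    i       _ = refl
  sumBelow-S≡sumZ (suc c) (suc i) _ rewrite sumBelow≡sumFrom (suc c) (S (suc i)) =
    trans (ℤ.+-identityˡ _) (sym (sumZ≡sumFrom 1 c _))

  sumBelow-S-deficit : ∀ c m →
    - + Transfer.sumBelow c (λ i → S (suc m) i ℕ.* (c ∸ i)) ≡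
    sumZ 1 (c ∸ 1) (λ i → (+ (i + 2) - + suc (suc c)) * + S (suc m) i)
  sumBelow-S-deficit zero    m = refl
  sumBelow-S-deficit (suc c) m rewrite sumBelow≡sumFrom (suc c) (λ i → S (suc m) i ℕ.* (suc c ∸ i)) =
    trans (cong -_ (ℤ.+-identityˡ _))
          (trans (sym (sumFrom-neg 1 c (λ i → + (S (suc m) i ℕ.* (suc c ∸ i)))))
                 (trans (sumFrom-cong 1 c termwise) (sym (sumZ≡sumFrom 1 c _))))
    where
      ring : ∀ i x d → - (x * d) ≡ (i ⊕ + 2 - (+ 2 ⊕ (d ⊕ i))) * x
      ring = solve-∀
      termwise : ∀ i → 1 ≤ i → i < 1 + c →
        - + (S (suc m) i ℕ.* (suc c ∸ i)) ≡ (+ (i + 2) - + suc (suc (suc c))) * + S (suc m) i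
      termwise i _ i<1+c = begin
          - + (S (suc m) i ℕ.* (suc c ∸ i))
        ≡⟨ cong -_ (ℤ.pos-* (S (suc m) i) (suc c ∸ i)) ⟩
          - (+ S (suc m) i * + (suc c ∸ i))
        ≡⟨ ring (+ i) (+ S (suc m) i) (+ (suc c ∸ i)) ⟩
          (+ i ⊕ + 2 - (+ 2 ⊕ (+ (suc c ∸ i) ⊕ + i))) * + S (suc m) i
        ≡⟨ cong₂ (λ u v → (u - v) * + S (suc m) i) (sym (ℤ.pos-+ i 2))
             (trans (cong (+ 2 ⊕_) (sym (ℤ.pos-+ (suc c ∸ i) i)))
                    (trans (sym (ℤ.pos-+ 2 _)) (cong (λ u → + (2 + u)) (ℕ.m∸n+n≡m (ℕ.<⇒≤ i<1+c))))) ⟩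
          (+ (i + 2) - + suc (suc (suc c))) * + S (suc m) i
        ∎
        where open ≡-Reasoning

  private
    ⊕-cancelʳ : ∀ a p b → a + p ≡ b → + a ≡ + b - + p
    ⊕-cancelʳ a p b a+p≡b = trans (ring (+ a) (+ p)) (cong (_- + p) (trans (sym (ℤ.pos-+ a p)) (cong +_ a+p≡b)))
      where ring : ∀ a p → a ≡ a ⊕ p - p
            ring = solve-∀

  module _ (c : ℕ) (f : ℕ → ℕ) (f≡walks : ∀ t → f t ≡ Transfer.walks c t 0 0) where
    open Transfer

    walks-c1≡sumZ : ∀ t → + walks c t c 1 ≡ sumZ 1 (suc c) (λ r → s (suc c) r * + f (t + r))
    walks-c1≡sumZ t = begin
        + walks c t c 1
      ≡⟨ sym (fallingShift-walks-c1 c t) ⟩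
        s (suc c) 0 * + walks c (t + 0) 0 0 ⊕ sumFrom 1 (suc c) (λ r → s (suc c) r * + walks c (t + r) 0 0)
      ≡⟨ cong (_⊕ sumFrom 1 (suc c) (λ r → s (suc c) r * + walks c (t + r) 0 0)) (ℤ.*-zeroˡ (+ walks c (t + 0) 0 0)) ⟩
        0ℤ ⊕ sumFrom 1 (suc c) (λ r → s (suc c) r * + walks c (t + r) 0 0)
      ≡⟨ ℤ.+-identityˡ _ ⟩
        sumFrom 1 (suc c) (λ r → s (suc c) r * + walks c (t + r) 0 0)
      ≡⟨ sumFrom-cong 1 (suc c) (λ r _ _ → cong (λ u → s (suc c) r * + u) (sym (f≡walks (t + r)))) ⟩
        sumFrom 1 (suc c) (λ r → s (suc c) r * + f (t + r))
      ≡⟨ sym (sumZ≡sumFrom 1 (suc c) (λ r → s (suc c) r * + f (t + r))) ⟩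
        sumZ 1 (suc c) (λ r → s (suc c) r * + f (t + r))
      ∎
      where open ≡-Reasoning

    steps-saturated≡ : ∀ i → c ≤ i → + steps c i (saturated c) 0 0 ≡ + f i - sumZ 1 (c ∸ 1) (λ j → + S i j)
    steps-saturated≡ i c≤i =
      trans (⊕-cancelʳ _ _ _ (trans (steps-saturated+unsaturated c i) (sym (f≡walks i))))
            (cong (λ u → + f i - u)
                  (trans (cong +_ (trans (steps-yOnly c (unsaturated c) (unsaturated-c c) i) unsaturated-drops))
                         (sumBelow-S≡sumZ c i c≤i)))
      where
        unsaturated-drops : sumBelow c (λ j → S i j ℕ.* unsaturated c j) ≡ sumBelow c (S i)
        unsaturated-drops = sumBelow-cong c (λ j j<c → trans (cong (S i j ℕ.*_) (unsaturated-< j<c)) (ℕ.*-identityʳ _))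
          where unsaturated-< : ∀ {j} → j < c → unsaturated c j ≡ 1
                unsaturated-< {j} j<c with j ℕ.<? c
                ... | yes _   = refl
                ... | no  j≮c = ⊥-elim (j≮c j<c)

    convSaturated≡sumZ : ∀ m →
      + conv (λ i → steps c i (saturated c) 0 0) (λ t → walks c t c 1) (suc m) ≡
      sumZ c m (λ i → (+ f i - sumZ 1 (c ∸ 1) (λ j → + S i j)) * sumZ 1 (suc c) (λ r → s (suc c) r * + f (m ∸ i + r)))
    convSaturated≡sumZ m =
      trans (conv≡sumFrom (suc m) A B) (trans (split (c ℕ.≤? suc m)) (sym (sumZ≡sumFrom c m g)))
      where
        A B : ℕ → ℕ
        A i = steps c i (saturated c) 0 0
        B t = walks c t c 1
        h g : ℕ → ℤ
        h i = + A i * + B (suc m ∸ suc i)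
        g i = (+ f i - sumZ 1 (c ∸ 1) (λ j → + S i j)) * sumZ 1 (suc c) (λ r → s (suc c) r * + f (m ∸ i + r))
        h-early : ∀ i → i < c → h i ≡ 0ℤ
        h-early i i<c rewrite steps-saturated-early c i 0 i<c = refl
        h≡g : ∀ i → c ≤ i → h i ≡ g i
        h≡g i c≤i = cong₂ _*_ (steps-saturated≡ i c≤i) (walks-c1≡sumZ (m ∸ i))
        split : Dec (c ≤ suc m) → sumFrom 0 (suc m) h ≡ sumFrom c (suc m ∸ c) g
        split (yes c≤1+m) = begin
            sumFrom 0 (suc m) h
          ≡⟨ cong (λ u → sumFrom 0 u h) (sym (ℕ.m+[n∸m]≡n c≤1+m)) ⟩
            sumFrom 0 (c + (suc m ∸ c)) h
          ≡⟨ sumFrom-++ 0 c (suc m ∸ c) h ⟩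
            sumFrom 0 c h ⊕ sumFrom c (suc m ∸ c) h
          ≡⟨ cong (_⊕ sumFrom c (suc m ∸ c) h) (sumFrom-zero 0 c h (λ i _ i<c → h-early i i<c)) ⟩
            0ℤ ⊕ sumFrom c (suc m ∸ c) h
          ≡⟨ ℤ.+-identityˡ _ ⟩
            sumFrom c (suc m ∸ c) h
          ≡⟨ sumFrom-cong c (suc m ∸ c) (λ i c≤i _ → h≡g i c≤i) ⟩
            sumFrom c (suc m ∸ c) g
          ∎
          where open ≡-Reasoning
        split (no c≰1+m) =
          trans (sumFrom-zero 0 (suc m) h (λ i _ i<1+m → h-early i (ℕ.<-≤-trans i<1+m 1+m≤c)))
                (cong (λ u → sumFrom c u g) (sym (ℕ.m≤n⇒m∸n≡0 1+m≤c)))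
          where 1+m≤c = ℕ.<⇒≤ (ℕ.≰⇒> c≰1+m)

    walks-recurrence : ∀ m →
      + f (suc (suc m)) ≡
        (+ suc c * + f (suc m)
        ⊕ sumZ 1 (c ∸ 1) (λ i → (+ (i + 2) - + suc (suc c)) * + S (suc m) i))
        ⊕ sumZ c m (λ i →
            (+ f i - sumZ 1 (c ∸ 1) (λ j → + S i j))
            * sumZ 1 (suc c) (λ r → s (suc c) r * + f (m ∸ i + r)))
    walks-recurrence m = begin
        + f (suc (suc m))
      ≡⟨ cong +_ (f≡walks (suc (suc m))) ⟩
        + walks c (suc (suc m)) 0 0
      ≡⟨ toℤ (walks c (suc (suc m)) 0 0) Y (suc c ℕ.* walks c (suc m) 0 0) Cv identity ⟩
        + (suc c ℕ.* walks c (suc m) 0 0) ⊕ - + Y ⊕ + Cv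
      ≡⟨ cong₂ _⊕_ (cong₂ _⊕_ (trans (ℤ.pos-* (suc c) _) (cong (+ suc c *_) (cong +_ (sym (f≡walks (suc m))))))
                              (sumBelow-S-deficit c m))
                   (convSaturated≡sumZ m) ⟩
        _
      ∎
      where
        open ≡-Reasoning
        Y Cv : ℕ
        Y = sumBelow c (λ i → S (suc m) i ℕ.* (c ∸ i))
        Cv = conv (λ i → steps c i (saturated c) 0 0) (λ t → walks c t c 1) (suc m)
        identity : walks c (suc (suc m)) 0 0 + Y ≡ suc c ℕ.* walks c (suc m) 0 0 + Cv
        identity = begin
            walks c (suc (suc m)) 0 0 + Y
          ≡⟨ cong (λ u → walks c (suc (suc m)) 0 0 + u) (sym (steps-yOnly c (c ∸_) (ℕ.n∸n≡0 c) (suc m))) ⟩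
            walks c (suc (suc m)) 0 0 + steps c (suc m) (deficit c) 0 0
          ≡⟨ walks-suc c (suc m) 0 0 z≤n ⟩
            suc c ℕ.* walks c (suc m) 0 0 + steps c (suc m) (sCoord c) 0 0
          ≡⟨ cong (λ u → suc c ℕ.* walks c (suc m) 0 0 + u) (steps-sCoord c (suc m) 0 0 z≤n) ⟩
            suc c ℕ.* walks c (suc m) 0 0 + Cv
          ∎
        toℤ : ∀ a y b z → a + y ≡ b + z → + a ≡ + b ⊕ - + y ⊕ + z
        toℤ a y b z eq = trans (⊕-cancelʳ a y (b + z) eq) (trans (cong (_- + y) (ℤ.pos-+ b z)) (ring (+ b) (+ y) (+ z)))
          where ring : ∀ b y z → b ⊕ z - y ≡ b ⊕ - y ⊕ z
                ring = solve-∀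

module Words where

  open import Data.Nat as ℕ using (ℕ; zero; suc; _+_; _∸_; _≤_; _<_; z≤n; s≤s)
  import Data.Nat.Properties as ℕ
  open import Data.Bool using (Bool; true; false; _∧_; not; T)
  open import Data.Bool.Properties using (∧-zeroʳ)
  open import Data.Fin as F using (Fin; inject₁; fromℕ; toℕ)
  import Data.Fin.Properties as F
  open import Data.Vec as V using (Vec; []; _∷_; lookup; _∷ʳ_)
  open import Data.List using (List; length; filter; tabulate; allFin)
  import Data.List as List
  import Data.List.Properties as List
  open import Data.Nat.ListAction using () renaming (sum to sumList)
  open import Data.Product using (∃; _×_; _,_; proj₁; proj₂)
  open import Data.Sum using (_⊎_; inj₁; inj₂; [_,_]′)
  open import Data.Empty using (⊥-elim)
  open import Function using (_∘_; mk⇔)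
  open import Relation.Nullary using (¬_; ¬?; Dec; yes; no; does)
  open import Relation.Nullary.Decidable using (_×-dec_; dec-true; dec-false; does-⇔)
  open import Relation.Unary using (Pred; Decidable)
  open import Relation.Binary using (tri<; tri≈; tri>)
  open import Relation.Binary.PropositionalEquality
  open import Algebra.Properties.CommutativeMonoid.Sum ℕ.+-0-commutativeMonoid
    using (sum; sum-cong-≗; sum-init-last; ∑-distrib-+)
  open import Defs hiding (s)
  open import Level using (0ℓ)

  indicator : Bool → ℕ
  indicator true  = 1
  indicator false = 0

  count : ∀ n → (Fin n → Bool) → ℕ
  count n Q = sum (indicator ∘ Q)

  length-filter-tabulate : ∀ {m} n {p} {P : Pred (Fin m) p} (P? : Decidable P) (g : Fin n → Fin m) →
    length (filter P? (tabulate g)) ≡ count n (λ i → does (P? (g i)))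
  length-filter-tabulate zero    P? g = refl
  length-filter-tabulate (suc n) P? g with does (P? (g F.zero))
  ... | true  = cong suc (length-filter-tabulate n P? (g ∘ F.suc))
  ... | false = length-filter-tabulate n P? (g ∘ F.suc)

  length-filter-allFin : ∀ n {p} {P : Pred (Fin n) p} (P? : Decidable P) →
    length (filter P? (allFin n)) ≡ count n (does ∘ P?)
  length-filter-allFin n P? = length-filter-tabulate n P? (λ i → i)

  count-cong : ∀ n {Q R : Fin n → Bool} → (∀ i → Q i ≡ R i) → count n Q ≡ count n R
  count-cong n Q≗R = sum-cong-≗ (cong indicator ∘ Q≗R)

  count-∷ʳ : ∀ n (Q : Fin (suc n) → Bool) → count (suc n) Q ≡ count n (Q ∘ inject₁) + indicator (Q (fromℕ n))
  count-∷ʳ n Q = sum-init-last (indicator ∘ Q)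

  sum-mono : ∀ n {f g : Fin n → ℕ} → (∀ i → f i ≤ g i) → sum f ≤ sum g
  sum-mono zero    f≤g = z≤n
  sum-mono (suc n) f≤g = ℕ.+-mono-≤ (f≤g F.zero) (sum-mono n (f≤g ∘ F.suc))

  count-mono : ∀ n {Q R : Fin n → Bool} → (∀ i → T (Q i) → T (R i)) → count n Q ≤ count n R
  count-mono n Q⇒R = sum-mono n (λ i → indicator-mono (Q⇒R i))
    where indicator-mono : ∀ {a b} → (T a → T b) → indicator a ≤ indicator b
          indicator-mono {true}  {true}  _ = ℕ.≤-refl
          indicator-mono {true}  {false} f = ⊥-elim (f _)
          indicator-mono {false}         _ = z≤n

  count-≤ : ∀ n (Q : Fin n → Bool) → count n Q ≤ n
  count-≤ zero    Q = z≤n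
  count-≤ (suc n) Q = ℕ.+-mono-≤ (indicator≤1 (Q F.zero)) (count-≤ n (Q ∘ F.suc))
    where indicator≤1 : ∀ b → indicator b ≤ 1
          indicator≤1 true  = ℕ.≤-refl
          indicator≤1 false = z≤n

  count-single : ∀ n (Q : Fin n → Bool) j → (∀ i → i ≢ j → Q i ≡ false) → count n Q ≡ indicator (Q j)
  count-single (suc n) Q F.zero Q≡false =
    trans (cong (indicator (Q F.zero) +_) (count-false n (λ i → Q≡false (F.suc i) (λ ())))) (ℕ.+-identityʳ _)
    where count-false : ∀ n {R : Fin n → Bool} → (∀ i → R i ≡ false) → count n R ≡ 0
          count-false zero    _    = refl
          count-false (suc n) R≡ff rewrite R≡ff F.zero = count-false n (R≡ff ∘ F.suc)
  count-single (suc n) Q (F.suc j) Q≡false rewrite Q≡false F.zero (λ ()) =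
    count-single n (Q ∘ F.suc) j (λ i i≢j → Q≡false (F.suc i) (i≢j ∘ F.suc-injective))

  count-trichotomy : ∀ n (Q : Fin n → Bool) i →
    count n Q ≡ count n (λ h → does (h F.<? i) ∧ Q h) + indicator (Q i) + count n (λ h → does (i F.<? h) ∧ Q h)
  count-trichotomy n Q i = begin
      sum (indicator ∘ Q)
    ≡⟨ sum-cong-≗ pointwise ⟩
      sum (λ h → indicator (does (h F.<? i) ∧ Q h) + indicator (does (h F.≟ i) ∧ Q h) + indicator (does (i F.<? h) ∧ Q h))
    ≡⟨ ∑-distrib-+ (λ h → indicator (does (h F.<? i) ∧ Q h) + indicator (does (h F.≟ i) ∧ Q h)) (λ h → indicator (does (i F.<? h) ∧ Q h)) ⟩
      sum (λ h → indicator (does (h F.<? i) ∧ Q h) + indicator (does (h F.≟ i) ∧ Q h)) + count n (λ h → does (i F.<? h) ∧ Q h)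
    ≡⟨ cong (_+ count n (λ h → does (i F.<? h) ∧ Q h)) (trans (∑-distrib-+ (λ h → indicator (does (h F.<? i) ∧ Q h)) (λ h → indicator (does (h F.≟ i) ∧ Q h))) (cong (count n (λ h → does (h F.<? i) ∧ Q h) +_) middle)) ⟩
      count n (λ h → does (h F.<? i) ∧ Q h) + indicator (Q i) + count n (λ h → does (i F.<? h) ∧ Q h)
    ∎
    where
      open ≡-Reasoning
      pointwise : ∀ h → indicator (Q h) ≡
        indicator (does (h F.<? i) ∧ Q h) + indicator (does (h F.≟ i) ∧ Q h) + indicator (does (i F.<? h) ∧ Q h)
      pointwise h with F.<-cmp h i
      ... | tri< h<i h≢i _ rewrite dec-true (h F.<? i) h<i | dec-false (h F.≟ i) h≢i | dec-false (i F.<? h) (F.<-asym h<i) =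
        sym (trans (ℕ.+-identityʳ _) (ℕ.+-identityʳ _))
      ... | tri≈ _ refl _ rewrite dec-false (h F.<? h) (F.<-irrefl refl) | dec-true (h F.≟ h) refl = sym (ℕ.+-identityʳ _)
      ... | tri> _ h≢i i<h rewrite dec-false (h F.<? i) (F.<-asym i<h) | dec-false (h F.≟ i) h≢i | dec-true (i F.<? h) i<h = refl
      middle : count n (λ h → does (h F.≟ i) ∧ Q h) ≡ indicator (Q i)
      middle = trans (count-single n _ i (λ h h≢i → cong (_∧ Q h) (dec-false (h F.≟ i) h≢i)))
                     (cong (λ b → indicator (b ∧ Q i)) (dec-true (i F.≟ i) refl))

  inject₁-or-fromℕ : ∀ {n} (j : Fin (suc n)) → (∃ λ i → j ≡ inject₁ i) ⊎ j ≡ fromℕ n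
  inject₁-or-fromℕ {zero}  F.zero    = inj₂ refl
  inject₁-or-fromℕ {suc n} F.zero    = inj₁ (F.zero , refl)
  inject₁-or-fromℕ {suc n} (F.suc j) with inject₁-or-fromℕ j
  ... | inj₁ (i , refl) = inj₁ (F.suc i , refl)
  ... | inj₂ refl       = inj₂ refl

  lookup-∷ʳ-inject₁ : ∀ {n} (p : Vec ℕ n) x i → lookup (p ∷ʳ x) (inject₁ i) ≡ lookup p i
  lookup-∷ʳ-inject₁ (y ∷ p) x F.zero    = refl
  lookup-∷ʳ-inject₁ (y ∷ p) x (F.suc i) = lookup-∷ʳ-inject₁ p x i

  lookup-∷ʳ-last : ∀ {n} (p : Vec ℕ n) x → lookup (p ∷ʳ x) (fromℕ n) ≡ x
  lookup-∷ʳ-last []      x = refl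
  lookup-∷ʳ-last (y ∷ p) x = lookup-∷ʳ-last p x

  module _ {n : ℕ} {i j : Fin n} where

    inject₁-mono-< : i F.< j → inject₁ i F.< inject₁ j
    inject₁-mono-< i<j rewrite F.toℕ-inject₁ i | F.toℕ-inject₁ j = i<j

    inject₁-cancel-< : inject₁ i F.< inject₁ j → i F.< j
    inject₁-cancel-< i<j rewrite F.toℕ-inject₁ i | F.toℕ-inject₁ j = i<j

  inject₁<fromℕ : ∀ {n} (i : Fin n) → inject₁ i F.< fromℕ n
  inject₁<fromℕ {n} i rewrite F.toℕ-fromℕ n = F.inject₁ℕ< i

  fromℕ≮ : ∀ {n} (j : Fin (suc n)) → ¬ fromℕ n F.< j
  fromℕ≮ {n} j fromℕ<j = ℕ.<⇒≱ fromℕ<j (subst (toℕ j ≤_) (sym (F.toℕ-fromℕ n)) (ℕ.s≤s⁻¹ (F.toℕ<n j)))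

  <-inject₁ : ∀ {n} (j k : Fin (suc n)) → j F.< k → ∃ λ j′ → j ≡ inject₁ j′
  <-inject₁ j k j<k with inject₁-or-fromℕ j
  ... | inj₁ j≡ = j≡
  ... | inj₂ refl = ⊥-elim (fromℕ≮ k j<k)

  numHeads : ∀ {n} → Vec ℕ n → ℕ
  numHeads {n} w = count n (λ h → does (isHead? w h))

  headsAfter : ∀ {n} → Vec ℕ n → Fin n → ℕ
  headsAfter {n} w a = count n (λ h → does (a F.<? h) ∧ does (isHead? w h))

  headsBefore≡count : ∀ {n} (w : Vec ℕ n) a → headsBefore w a ≡ count n (λ h → does (h F.<? a) ∧ does (isHead? w h))
  headsBefore≡count {n} w a = length-filter-allFin n (λ h → (h F.<? a) ×-dec isHead? w h)

  headsBetween≡count : ∀ {n} (w : Vec ℕ n) a b →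
    headsBetween w a b ≡ count n (λ h → does (a F.<? h) ∧ (does (h F.<? b) ∧ does (isHead? w h)))
  headsBetween≡count {n} w a b = length-filter-allFin n (λ h → (a F.<? h) ×-dec ((h F.<? b) ×-dec isHead? w h))

  count-∷ʳ-init : ∀ n (Q : Fin (suc n) → Bool) R → (∀ i → Q (inject₁ i) ≡ R i) → Q (fromℕ n) ≡ false →
    count (suc n) Q ≡ count n R
  count-∷ʳ-init n Q R Q≗R Qlast≡false =
    trans (count-∷ʳ n Q) (trans (cong₂ _+_ (count-cong n Q≗R) (cong indicator Qlast≡false)) (ℕ.+-identityʳ _))

  -- Appending a to p would complete a front crossing with at least t heads in the middle.
  Closed : ℕ → ∀ {n} → Vec ℕ n → ℕ → Set
  Closed t {n} p a = ∃ λ (i₁ : Fin n) → ∃ λ (i₂ : Fin n) → ∃ λ (j₁ : Fin n) →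
    FrontEdge p i₁ j₁ × IsHead p i₂ × lookup p i₂ ≡ a × i₁ F.< i₂ × i₂ F.< j₁ × t ≤ headsBetween p i₂ j₁

  -- Appending b to p closes a, through the new front edge from the head of b.
  ClosedBy : ℕ → ∀ {n} → Vec ℕ n → ℕ → ℕ → Set
  ClosedBy t {n} p b a = ∃ λ (i₁ : Fin n) → ∃ λ (i₂ : Fin n) →
    IsHead p i₁ × lookup p i₁ ≡ b × IsHead p i₂ × lookup p i₂ ≡ a × i₁ F.< i₂ × t ≤ headsAfter p i₂

  module Snoc {n : ℕ} (p : Vec ℕ n) (x : ℕ) where
    private
      w = p ∷ʳ x
      lookup-inject₁ = lookup-∷ʳ-inject₁ p x
      lookup-last = lookup-∷ʳ-last p x

    IsHead-inject₁⁻ : ∀ i → IsHead w (inject₁ i) → IsHead p i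
    IsHead-inject₁⁻ i head j j<i eq =
      head (inject₁ j) (inject₁-mono-< j<i) (trans (lookup-inject₁ j) (trans eq (sym (lookup-inject₁ i))))

    IsHead-inject₁ : ∀ i → IsHead p i → IsHead w (inject₁ i)
    IsHead-inject₁ i head j j<i eq with inject₁-or-fromℕ j
    ... | inj₁ (j′ , refl) =
      head j′ (inject₁-cancel-< j<i) (trans (sym (lookup-inject₁ j′)) (trans eq (lookup-inject₁ i)))
    ... | inj₂ refl = fromℕ≮ (inject₁ i) j<i

    IsHead-last⁻ : IsHead w (fromℕ n) → ∀ j → lookup p j ≢ x
    IsHead-last⁻ head j eq = head (inject₁ j) (inject₁<fromℕ j) (trans (lookup-inject₁ j) (trans eq (sym lookup-last)))

    IsHead-last : (∀ j → lookup p j ≢ x) → IsHead w (fromℕ n)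
    IsHead-last fresh j j<last eq with inject₁-or-fromℕ j
    ... | inj₁ (j′ , refl) = fresh j′ (trans (sym (lookup-inject₁ j′)) (trans eq lookup-last))
    ... | inj₂ refl        = F.<-irrefl refl j<last

    private
      does-isHead : ∀ i → does (isHead? w (inject₁ i)) ≡ does (isHead? p i)
      does-isHead i = does-⇔ (mk⇔ (IsHead-inject₁⁻ i) (IsHead-inject₁ i)) (isHead? w (inject₁ i)) (isHead? p i)

      does-< : ∀ (i j : Fin n) → does (inject₁ i F.<? inject₁ j) ≡ does (i F.<? j)
      does-< i j = does-⇔ (mk⇔ inject₁-cancel-< inject₁-mono-<) (inject₁ i F.<? inject₁ j) (i F.<? j)

      does-<-last : ∀ (i : Fin n) → does (inject₁ i F.<? fromℕ n) ≡ true
      does-<-last i = dec-true (inject₁ i F.<? fromℕ n) (inject₁<fromℕ i)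

      does-last-< : ∀ (j : Fin (suc n)) → does (fromℕ n F.<? j) ≡ false
      does-last-< j = dec-false (fromℕ n F.<? j) (fromℕ≮ j)

    private
      H : ∀ {m} → Vec ℕ m → Fin m → Bool
      H v h = does (isHead? v h)

    headsBefore-inject₁ : ∀ i → headsBefore w (inject₁ i) ≡ headsBefore p i
    headsBefore-inject₁ i =
      trans (headsBefore≡count w (inject₁ i))
            (trans (count-∷ʳ-init n (λ h → does (h F.<? inject₁ i) ∧ H w h) _
                                  (λ h → cong₂ _∧_ (does-< h i) (does-isHead h))
                                  (cong (_∧ H w (fromℕ n)) (does-last-< (inject₁ i))))
                   (sym (headsBefore≡count p i)))

    headsBefore-last : headsBefore w (fromℕ n) ≡ numHeads p
    headsBefore-last =
      trans (headsBefore≡count w (fromℕ n))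
            (count-∷ʳ-init n (λ h → does (h F.<? fromℕ n) ∧ H w h) _
                           (λ h → cong₂ _∧_ (does-<-last h) (does-isHead h))
                           (cong (_∧ H w (fromℕ n)) (does-last-< (fromℕ n))))

    headsBetween-inject₁ : ∀ a b → headsBetween w (inject₁ a) (inject₁ b) ≡ headsBetween p a b
    headsBetween-inject₁ a b =
      trans (headsBetween≡count w (inject₁ a) (inject₁ b))
            (trans (count-∷ʳ-init n (λ h → does (inject₁ a F.<? h) ∧ (does (h F.<? inject₁ b) ∧ H w h)) _
                                  (λ h → cong₂ _∧_ (does-< a h) (cong₂ _∧_ (does-< h b) (does-isHead h)))
                                  (trans (cong (λ z → does (inject₁ a F.<? fromℕ n) ∧ (z ∧ H w (fromℕ n)))
                                               (does-last-< (inject₁ b)))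
                                         (∧-zeroʳ _)))
                   (sym (headsBetween≡count p a b)))

    headsBetween-last : ∀ a → headsBetween w (inject₁ a) (fromℕ n) ≡ headsAfter p a
    headsBetween-last a =
      trans (headsBetween≡count w (inject₁ a) (fromℕ n))
            (count-∷ʳ-init n (λ h → does (inject₁ a F.<? h) ∧ (does (h F.<? fromℕ n) ∧ H w h)) _
                           (λ h → cong₂ _∧_ (does-< a h) (cong₂ _∧_ (does-<-last h) (does-isHead h)))
                           (trans (cong (λ z → does (inject₁ a F.<? fromℕ n) ∧ (z ∧ H w (fromℕ n)))
                                        (does-last-< (fromℕ n)))
                                  (∧-zeroʳ _)))

    numHeads-∷ʳ : numHeads w ≡ numHeads p + indicator (H w (fromℕ n))
    numHeads-∷ʳ = trans (count-∷ʳ n (H w)) (cong (_+ indicator (H w (fromℕ n))) (count-cong n does-isHead))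

    canonical-init : Canonical w → Canonical p
    canonical-init C i head =
      trans (sym (lookup-inject₁ i)) (trans (C (inject₁ i) (IsHead-inject₁ i head)) (cong suc (headsBefore-inject₁ i)))

    canonical-last : Canonical w → IsHead w (fromℕ n) → x ≡ suc (numHeads p)
    canonical-last C head = trans (sym lookup-last) (trans (C (fromℕ n) head) (cong suc headsBefore-last))

    canonical-∷ʳ : Canonical p → (IsHead w (fromℕ n) → x ≡ suc (numHeads p)) → Canonical w
    canonical-∷ʳ C last-fresh j head with inject₁-or-fromℕ j
    ... | inj₁ (i , refl) =
      trans (lookup-inject₁ i) (trans (C i (IsHead-inject₁⁻ i head)) (cong suc (sym (headsBefore-inject₁ i))))
    ... | inj₂ refl = trans lookup-last (trans (last-fresh head) (cong suc (sym headsBefore-last)))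

    FrontEdge-inject₁⁻ : ∀ i j → FrontEdge w (inject₁ i) (inject₁ j) → FrontEdge p i j
    FrontEdge-inject₁⁻ i j (i<j , eq , head) =
      inject₁-cancel-< i<j , trans (sym (lookup-inject₁ i)) (trans eq (lookup-inject₁ j)) , IsHead-inject₁⁻ i head

    FrontEdge-inject₁ : ∀ i j → FrontEdge p i j → FrontEdge w (inject₁ i) (inject₁ j)
    FrontEdge-inject₁ i j (i<j , eq , head) =
      inject₁-mono-< i<j , trans (lookup-inject₁ i) (trans eq (sym (lookup-inject₁ j))) , IsHead-inject₁ i head

    FrontEdge-last⁻ : ∀ i → FrontEdge w (inject₁ i) (fromℕ n) → lookup p i ≡ x × IsHead p i
    FrontEdge-last⁻ i (_ , eq , head) = trans (sym (lookup-inject₁ i)) (trans eq lookup-last) , IsHead-inject₁⁻ i head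

    FrontEdge-last : ∀ i → lookup p i ≡ x → IsHead p i → FrontEdge w (inject₁ i) (fromℕ n)
    FrontEdge-last i eq head = inject₁<fromℕ i , trans (lookup-inject₁ i) (trans eq (sym lookup-last)) , IsHead-inject₁ i head

    module _ (t : ℕ) where

      Closed-inject₁ : ∀ a → Closed t p a → Closed t w a
      Closed-inject₁ a (i₁ , i₂ , j₁ , e₁ , head₂ , eq , i₁<i₂ , i₂<j₁ , enough) =
        inject₁ i₁ , inject₁ i₂ , inject₁ j₁ , FrontEdge-inject₁ i₁ j₁ e₁ , IsHead-inject₁ i₂ head₂ ,
        trans (lookup-inject₁ i₂) eq , inject₁-mono-< i₁<i₂ , inject₁-mono-< i₂<j₁ ,
        subst (t ≤_) (sym (headsBetween-inject₁ i₂ j₁)) enough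

      ClosedBy⇒Closed : ∀ a → ClosedBy t p x a → Closed t w a
      ClosedBy⇒Closed a (i₁ , i₂ , head₁ , eq₁ , head₂ , eq₂ , i₁<i₂ , enough) =
        inject₁ i₁ , inject₁ i₂ , fromℕ n , FrontEdge-last i₁ eq₁ head₁ , IsHead-inject₁ i₂ head₂ ,
        trans (lookup-inject₁ i₂) eq₂ , inject₁-mono-< i₁<i₂ , inject₁<fromℕ i₂ ,
        subst (t ≤_) (sym (headsBetween-last i₂)) enough

      Closed-∷ʳ-cases : ∀ a → Closed t w a → Closed t p a ⊎ ClosedBy t p x a
      Closed-∷ʳ-cases a (i₁ , i₂ , j₁ , e₁ , head₂ , eq , i₁<i₂ , i₂<j₁ , enough) with <-inject₁ i₂ j₁ i₂<j₁
      ... | i₂′ , refl with <-inject₁ i₁ (inject₁ i₂′) i₁<i₂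
      ... | i₁′ , refl with inject₁-or-fromℕ j₁
      ... | inj₁ (j₁′ , refl) =
        inj₁ (i₁′ , i₂′ , j₁′ , FrontEdge-inject₁⁻ i₁′ j₁′ e₁ , IsHead-inject₁⁻ i₂′ head₂ ,
              trans (sym (lookup-inject₁ i₂′)) eq , inject₁-cancel-< i₁<i₂ , inject₁-cancel-< i₂<j₁ ,
              subst (t ≤_) (headsBetween-inject₁ i₂′ j₁′) enough)
      ... | inj₂ refl =
        inj₂ (i₁′ , i₂′ , proj₂ (FrontEdge-last⁻ i₁′ e₁) , proj₁ (FrontEdge-last⁻ i₁′ e₁) ,
              IsHead-inject₁⁻ i₂′ head₂ , trans (sym (lookup-inject₁ i₂′)) eq , inject₁-cancel-< i₁<i₂ ,
              subst (t ≤_) (headsBetween-last i₂′) enough)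

    module _ (k : ℕ) where

      crossing-inject₁ : HasFrontCrossing k p → HasFrontCrossing k w
      crossing-inject₁ (i₁ , i₂ , j₁ , j₂ , e₁ , e₂ , i₁<i₂ , i₂<j₁ , j₁<j₂ , enough) =
        inject₁ i₁ , inject₁ i₂ , inject₁ j₁ , inject₁ j₂ , FrontEdge-inject₁ i₁ j₁ e₁ , FrontEdge-inject₁ i₂ j₂ e₂ ,
        inject₁-mono-< i₁<i₂ , inject₁-mono-< i₂<j₁ , inject₁-mono-< j₁<j₂ ,
        subst (k ∸ 2 ≤_) (sym (headsBetween-inject₁ i₂ j₁)) enough

      Closed⇒crossing : Closed (k ∸ 2) p x → HasFrontCrossing k w
      Closed⇒crossing (i₁ , i₂ , j₁ , e₁ , head₂ , eq , i₁<i₂ , i₂<j₁ , enough) =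
        inject₁ i₁ , inject₁ i₂ , inject₁ j₁ , fromℕ n , FrontEdge-inject₁ i₁ j₁ e₁ , FrontEdge-last i₂ eq head₂ ,
        inject₁-mono-< i₁<i₂ , inject₁-mono-< i₂<j₁ , inject₁<fromℕ j₁ ,
        subst (k ∸ 2 ≤_) (sym (headsBetween-inject₁ i₂ j₁)) enough

      crossing-∷ʳ⁻ : HasFrontCrossing k w → HasFrontCrossing k p ⊎ Closed (k ∸ 2) p x
      crossing-∷ʳ⁻ (i₁ , i₂ , j₁ , j₂ , e₁ , e₂ , i₁<i₂ , i₂<j₁ , j₁<j₂ , enough)
        with <-inject₁ j₁ j₂ j₁<j₂ | <-inject₁ i₂ j₁ i₂<j₁
      ... | j₁′ , refl | i₂′ , refl with <-inject₁ i₁ (inject₁ i₂′) i₁<i₂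
      ... | i₁′ , refl with inject₁-or-fromℕ j₂
      ... | inj₁ (j₂′ , refl) =
        inj₁ (i₁′ , i₂′ , j₁′ , j₂′ , FrontEdge-inject₁⁻ i₁′ j₁′ e₁ , FrontEdge-inject₁⁻ i₂′ j₂′ e₂ ,
              inject₁-cancel-< i₁<i₂ , inject₁-cancel-< i₂<j₁ , inject₁-cancel-< j₁<j₂ ,
              subst (k ∸ 2 ≤_) (headsBetween-inject₁ i₂′ j₁′) enough)
      ... | inj₂ refl =
        inj₂ (i₁′ , i₂′ , j₁′ , FrontEdge-inject₁⁻ i₁′ j₁′ e₁ , proj₂ (FrontEdge-last⁻ i₂′ e₂) ,
              proj₁ (FrontEdge-last⁻ i₂′ e₂) , inject₁-cancel-< i₁<i₂ , inject₁-cancel-< i₂<j₁ ,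
              subst (k ∸ 2 ≤_) (headsBetween-inject₁ i₂′ j₁′) enough)

  module Heads {n : ℕ} (p : Vec ℕ n) where
    private
      H : Fin n → Bool
      H h = does (isHead? p h)

    numHeads-split : ∀ i → numHeads p ≡ headsBefore p i + indicator (H i) + headsAfter p i
    numHeads-split i =
      trans (count-trichotomy n H i) (cong (λ z → z + indicator (H i) + headsAfter p i) (sym (headsBefore≡count p i)))

    headsBefore<numHeads : ∀ i → IsHead p i → headsBefore p i < numHeads p
    headsBefore<numHeads i head rewrite numHeads-split i | dec-true (isHead? p i) head =
      ℕ.≤-trans (ℕ.≤-reflexive (ℕ.+-comm 1 (headsBefore p i))) (ℕ.m≤m+n _ _)

    headsAfter-head : ∀ i → IsHead p i → headsAfter p i ≡ numHeads p ∸ suc (headsBefore p i)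
    headsAfter-head i head rewrite numHeads-split i | dec-true (isHead? p i) head
                                 | ℕ.+-comm (headsBefore p i) 1 = sym (ℕ.m+n∸m≡n (suc (headsBefore p i)) (headsAfter p i))

    headsBefore-mono : ∀ i j → IsHead p i → i F.< j → suc (headsBefore p i) ≤ headsBefore p j
    headsBefore-mono i j head i<j = begin
        suc (headsBefore p i)
      ≡⟨ ℕ.+-comm 1 (headsBefore p i) ⟩
        headsBefore p i + 1
      ≡⟨ cong₂ _+_ (trans (headsBefore≡count p i) (sym (count-cong n before-i))) (sym Qi≡1) ⟩
        count n (λ h → does (h F.<? i) ∧ Q h) + indicator (Q i)
      ≤⟨ ℕ.m≤m+n _ _ ⟩
        count n (λ h → does (h F.<? i) ∧ Q h) + indicator (Q i) + count n (λ h → does (i F.<? h) ∧ Q h)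
      ≡⟨ sym (count-trichotomy n Q i) ⟩
        count n Q
      ≡⟨ sym (headsBefore≡count p j) ⟩
        headsBefore p j
      ∎
      where
        open ℕ.≤-Reasoning
        Q : Fin n → Bool
        Q h = does (h F.<? j) ∧ H h
        Qi≡1 : indicator (Q i) ≡ 1
        Qi≡1 rewrite dec-true (i F.<? j) i<j | dec-true (isHead? p i) head = refl
        before-i : ∀ h → does (h F.<? i) ∧ Q h ≡ does (h F.<? i) ∧ H h
        before-i h = absorb (does (h F.<? i)) (does (h F.<? j)) (H h)
                            (λ h<i → dec-true (h F.<? j) (F.<-trans (ℕ.<ᵇ⇒< (toℕ h) (toℕ i) h<i) i<j))
          where absorb : ∀ a b c → (T a → b ≡ true) → a ∧ (b ∧ c) ≡ a ∧ c
                absorb true  b c b≡true rewrite b≡true _ = refl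
                absorb false b c _      = refl

    headsBetween≤headsAfter : ∀ i j → headsBetween p i j ≤ headsAfter p i
    headsBetween≤headsAfter i j = subst (_≤ headsAfter p i) (sym (headsBetween≡count p i j)) (count-mono n drop-middle)
      where drop-middle : ∀ h → T (does (i F.<? h) ∧ (does (h F.<? j) ∧ H h)) → T (does (i F.<? h) ∧ H h)
            drop-middle h with does (i F.<? h) | does (h F.<? j) | H h
            ... | true | true | true = _

  LabelledByHeads : ∀ {n} → Vec ℕ n → Set
  LabelledByHeads {n} p =
    (∀ j → 1 ≤ lookup p j × lookup p j ≤ numHeads p) ×
    (∀ ℓ → 1 ≤ ℓ → ℓ ≤ numHeads p → ∃ λ i → IsHead p i × lookup p i ≡ ℓ)

  Good : ℕ → ∀ {n} → Vec ℕ n → Set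
  Good k w = Canonical w × FrontNoncrossing k w

  module Labels {n : ℕ} (p : Vec ℕ n) (C : Canonical p) where
    open Heads p

    head-label-< : ∀ i j → IsHead p i → IsHead p j → i F.< j → lookup p i < lookup p j
    head-label-< i j head-i head-j i<j rewrite C i head-i | C j head-j = s≤s (headsBefore-mono i j head-i i<j)

    head-label-<⁻ : ∀ i j → IsHead p i → IsHead p j → lookup p i < lookup p j → i F.< j
    head-label-<⁻ i j head-i head-j lt with F.<-cmp i j
    ... | tri< i<j _ _ = i<j
    ... | tri≈ _ refl _ = ⊥-elim (ℕ.<-irrefl refl lt)
    ... | tri> _ _ j<i = ⊥-elim (ℕ.<-asym lt (head-label-< j i head-j head-i j<i))

    headsAfter-label : ∀ i → IsHead p i → headsAfter p i ≡ numHeads p ∸ lookup p i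
    headsAfter-label i head rewrite C i head = headsAfter-head i head

    head-label-≤ : ∀ i → IsHead p i → lookup p i ≤ numHeads p
    head-label-≤ i head rewrite C i head = headsBefore<numHeads i head

    Closed-bounds : ∀ t a → Closed t p a → 1 ≤ a × a ≤ numHeads p × t ≤ numHeads p ∸ a
    Closed-bounds t a (i₁ , i₂ , j₁ , _ , head₂ , refl , _ , _ , enough) =
      subst (1 ≤_) (sym (C i₂ head₂)) (s≤s z≤n) , head-label-≤ i₂ head₂ ,
      ℕ.≤-trans enough (ℕ.≤-trans (headsBetween≤headsAfter i₂ j₁) (ℕ.≤-reflexive (headsAfter-label i₂ head₂)))

    ClosedBy-bounds : ∀ t b a → ClosedBy t p b a → 1 ≤ b × b < a × a ≤ numHeads p × t ≤ numHeads p ∸ a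
    ClosedBy-bounds t b a (i₁ , i₂ , head₁ , refl , head₂ , refl , i₁<i₂ , enough) =
      subst (1 ≤_) (sym (C i₁ head₁)) (s≤s z≤n) , head-label-< i₁ i₂ head₁ head₂ i₁<i₂ , head-label-≤ i₂ head₂ ,
      ℕ.≤-trans enough (ℕ.≤-reflexive (headsAfter-label i₂ head₂))

    ClosedBy-intro : LabelledByHeads p → ∀ t b a → 1 ≤ b → b < a → a ≤ numHeads p → t ≤ numHeads p ∸ a → ClosedBy t p b a
    ClosedBy-intro (_ , onto) t b a 1≤b b<a a≤m enough
      with onto b 1≤b (ℕ.≤-trans (ℕ.<⇒≤ b<a) a≤m) | onto a (ℕ.≤-trans 1≤b (ℕ.<⇒≤ b<a)) a≤m
    ... | i₁ , head₁ , refl | i₂ , head₂ , refl =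
      i₁ , i₂ , head₁ , refl , head₂ , refl , head-label-<⁻ i₁ i₂ head₁ head₂ b<a ,
      subst (t ≤_) (sym (headsAfter-label i₂ head₂)) enough

  module Extend (k : ℕ) {n : ℕ} (p : Vec ℕ n) (b : ℕ) where
    open Snoc p b
    private
      w = p ∷ʳ b
      m = numHeads p

    Good-init : Good k w → Good k p
    Good-init (C , nc) = canonical-init C , nc ∘ crossing-inject₁ k

    module _ (C : Canonical p) (nc : FrontNoncrossing k p) (L : LabelledByHeads p) where

      last-not-head : 1 ≤ b → b ≤ m → ¬ IsHead w (fromℕ n)
      last-not-head 1≤b b≤m head with proj₂ L b 1≤b b≤m
      ... | i , _ , eq = IsHead-last⁻ head i eq

      last-head : b ≡ suc m → IsHead w (fromℕ n)
      last-head refl = IsHead-last (λ j eq → ℕ.<-irrefl eq (s≤s (proj₂ (proj₁ L j))))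

      Good-∷ʳ : 1 ≤ b → b ≤ suc m → ¬ Closed (k ∸ 2) p b → Good k w
      Good-∷ʳ 1≤b b≤1+m open-b = canonical-∷ʳ C fresh , [ nc , open-b ]′ ∘ crossing-∷ʳ⁻ k
        where fresh : IsHead w (fromℕ n) → b ≡ suc m
              fresh head with b ℕ.≤? m
              ... | yes b≤m = ⊥-elim (last-not-head 1≤b b≤m head)
              ... | no  b≰m = ℕ.≤-antisym b≤1+m (ℕ.≰⇒> b≰m)

      Good-∷ʳ⁻ : Good k w → 1 ≤ b × b ≤ suc m × ¬ Closed (k ∸ 2) p b
      Good-∷ʳ⁻ (Cw , ncw) with F.any? (λ j → lookup p j ℕ.≟ b)
      ... | yes (j , refl) = proj₁ (proj₁ L j) , ℕ.m≤n⇒m≤1+n (proj₂ (proj₁ L j)) , ncw ∘ Closed⇒crossing k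
      ... | no  absent =
        let b≡1+m = canonical-last Cw (IsHead-last (λ j eq → absent (j , eq))) in
        subst (1 ≤_) (sym b≡1+m) (s≤s z≤n) , ℕ.≤-reflexive b≡1+m , ncw ∘ Closed⇒crossing k

      numHeads-old : 1 ≤ b → b ≤ m → numHeads w ≡ m
      numHeads-old 1≤b b≤m =
        trans numHeads-∷ʳ (trans (cong (λ z → m + indicator z) (dec-false (isHead? w (fromℕ n)) (last-not-head 1≤b b≤m)))
                                 (ℕ.+-identityʳ m))

      numHeads-new : b ≡ suc m → numHeads w ≡ suc m
      numHeads-new b≡1+m =
        trans numHeads-∷ʳ (trans (cong (λ z → m + indicator z) (dec-true (isHead? w (fromℕ n)) (last-head b≡1+m)))
                                 (ℕ.+-comm m 1))

      LabelledByHeads-∷ʳ : 1 ≤ b → b ≤ suc m → LabelledByHeads w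
      LabelledByHeads-∷ʳ 1≤b b≤1+m with b ℕ.≤? m
      ... | yes b≤m rewrite numHeads-old 1≤b b≤m = bounded , onto
        where
          bounded : ∀ j → 1 ≤ lookup w j × lookup w j ≤ m
          bounded j with inject₁-or-fromℕ j
          ... | inj₁ (j′ , refl) rewrite lookup-∷ʳ-inject₁ p b j′ = proj₁ L j′
          ... | inj₂ refl        rewrite lookup-∷ʳ-last p b = 1≤b , b≤m
          onto : ∀ ℓ → 1 ≤ ℓ → ℓ ≤ m → ∃ λ i → IsHead w i × lookup w i ≡ ℓ
          onto ℓ 1≤ℓ ℓ≤m with proj₂ L ℓ 1≤ℓ ℓ≤m
          ... | i , head , eq = inject₁ i , IsHead-inject₁ i head , trans (lookup-∷ʳ-inject₁ p b i) eq
      ... | no b≰m with ℕ.≤-antisym b≤1+m (ℕ.≰⇒> b≰m)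
      ... | b≡1+m rewrite numHeads-new b≡1+m = bounded , onto
        where
          bounded : ∀ j → 1 ≤ lookup w j × lookup w j ≤ suc m
          bounded j with inject₁-or-fromℕ j
          ... | inj₁ (j′ , refl) rewrite lookup-∷ʳ-inject₁ p b j′ = proj₁ (proj₁ L j′) , ℕ.m≤n⇒m≤1+n (proj₂ (proj₁ L j′))
          ... | inj₂ refl        rewrite lookup-∷ʳ-last p b = 1≤b , b≤1+m
          onto : ∀ ℓ → 1 ≤ ℓ → ℓ ≤ suc m → ∃ λ i → IsHead w i × lookup w i ≡ ℓ
          onto ℓ 1≤ℓ ℓ≤1+m with ℓ ℕ.≤? m
          ... | yes ℓ≤m with proj₂ L ℓ 1≤ℓ ℓ≤m
          ...   | i , head , eq = inject₁ i , IsHead-inject₁ i head , trans (lookup-∷ʳ-inject₁ p b i) eq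
          onto ℓ 1≤ℓ ℓ≤1+m | no ℓ≰m =
            fromℕ n , last-head b≡1+m , trans (lookup-∷ʳ-last p b) (trans b≡1+m (sym (ℕ.≤-antisym ℓ≤1+m (ℕ.≰⇒> ℓ≰m))))

  Closed? : ∀ t {n} (p : Vec ℕ n) a → Dec (Closed t p a)
  Closed? t p a = F.any? λ i₁ → F.any? λ i₂ → F.any? λ j₁ →
    frontEdge? p i₁ j₁ ×-dec (isHead? p i₂ ×-dec ((lookup p i₂ ℕ.≟ a) ×-dec
    ((i₁ F.<? i₂) ×-dec ((i₂ F.<? j₁) ×-dec (t ℕ.≤? headsBetween p i₂ j₁)))))

  module _ (t : ℕ) {n : ℕ} (p : Vec ℕ n) (b : ℕ) (C : Canonical p) where
    open Labels p C

    Closed-∷ʳ⁻ : ∀ a → Closed t (p ∷ʳ b) a → Closed t p a ⊎ (b < a × a ≤ numHeads p × t ≤ numHeads p ∸ a)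
    Closed-∷ʳ⁻ a closed with Snoc.Closed-∷ʳ-cases p b t a closed
    ... | inj₁ before = inj₁ before
    ... | inj₂ by-b with ClosedBy-bounds t b a by-b
    ...   | _ , b<a , a≤m , enough = inj₂ (b<a , a≤m , enough)

    Closed-∷ʳ : LabelledByHeads p → 1 ≤ b →
      ∀ a → Closed t p a ⊎ (b < a × a ≤ numHeads p × t ≤ numHeads p ∸ a) → Closed t (p ∷ʳ b) a
    Closed-∷ʳ L 1≤b a (inj₁ before) = Snoc.Closed-inject₁ p b t a before
    Closed-∷ʳ L 1≤b a (inj₂ (b<a , a≤m , enough)) =
      Snoc.ClosedBy⇒Closed p b t a (ClosedBy-intro L t b a 1≤b b<a a≤m enough)

  good? : ∀ k {n} (w : Vec ℕ n) → Dec (Good k w)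
  good? k w = canonical? w ×-dec ¬? (hasFrontCrossing? k w)

  completions : ℕ → ℕ → ∀ {n} → Vec ℕ n → ℕ → ℕ
  completions k N p L = length (filter (λ v → good? k (p V.++ v)) (words L (oneTo N)))

  private
    cong-toList : ∀ {n n′} (u : Vec ℕ n) (v : Vec ℕ n′) → V.toList u ≡ V.toList v →
      (D : ∀ {m} → Vec ℕ m → Bool) → D u ≡ D v
    cong-toList []      []      eq D = refl
    cong-toList (x ∷ u) (y ∷ v) eq D with List.∷-injective eq
    ... | refl , eq′ = cong-toList u v eq′ (D ∘ (x ∷_))

    toList-++-∷ : ∀ {n L} (p : Vec ℕ n) a (v : Vec ℕ L) → V.toList (p V.++ (a ∷ v)) ≡ V.toList ((p ∷ʳ a) V.++ v)
    toList-++-∷ []      a v = refl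
    toList-++-∷ (x ∷ p) a v = cong (x List.∷_) (toList-++-∷ p a v)

    toList-++-[] : ∀ {n} (p : Vec ℕ n) → V.toList (p V.++ []) ≡ V.toList p
    toList-++-[] []      = refl
    toList-++-[] (x ∷ p) = cong (x List.∷_) (toList-++-[] p)

    length-filter-cong : ∀ {A : Set} {P Q : Pred A 0ℓ} (P? : Decidable P) (Q? : Decidable Q) xs →
      (∀ x → does (P? x) ≡ does (Q? x)) → length (filter P? xs) ≡ length (filter Q? xs)
    length-filter-cong P? Q? List.[]       eq = refl
    length-filter-cong P? Q? (x List.∷ xs) eq with does (P? x) | does (Q? x) | eq x
    ... | true  | true  | _ = cong suc (length-filter-cong P? Q? xs eq)
    ... | false | false | _ = length-filter-cong P? Q? xs eq

    length-filter-map : ∀ {A B : Set} {P : Pred B 0ℓ} (P? : Decidable P) (g : A → B) xs →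
      length (filter P? (List.map g xs)) ≡ length (filter (P? ∘ g) xs)
    length-filter-map P? g List.[] = refl
    length-filter-map P? g (x List.∷ xs) with does (P? (g x))
    ... | true  = cong suc (length-filter-map P? g xs)
    ... | false = length-filter-map P? g xs

    length-filter-concat : ∀ {A B : Set} {P : Pred B 0ℓ} (P? : Decidable P) (g : A → List B) xs →
      length (filter P? (List.concat (List.map g xs))) ≡ sumList (List.map (λ a → length (filter P? (g a))) xs)
    length-filter-concat P? g List.[] = refl
    length-filter-concat P? g (x List.∷ xs)
      rewrite List.filter-++ P? (g x) (List.concat (List.map g xs))
            | List.length-++ (filter P? (g x)) {filter P? (List.concat (List.map g xs))} =
      cong (length (filter P? (g x)) +_) (length-filter-concat P? g xs)

    sum-map-oneTo : ∀ (h : ℕ → ℕ) N → sumList (List.map h (oneTo N)) ≡ Transfer.sumTo N h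
    sum-map-oneTo h N = trans (cong sumList (sym (List.map-∘ (List.upTo N))))
                              (trans (go (h ∘ suc) (λ i → i) N) (Transfer.sumBelow-suc N h))
      where
        go : ∀ (h f : ℕ → ℕ) t → sumList (List.map h (List.applyUpTo f t)) ≡ Transfer.sumBelow t (h ∘ f)
        go h f zero    = refl
        go h f (suc t) = trans (cong (h (f 0) +_) (go h (f ∘ suc) t)) (sym (sumBelow-head t (h ∘ f)))
          where sumBelow-head : ∀ t (g : ℕ → ℕ) → Transfer.sumBelow (suc t) g ≡ g 0 + Transfer.sumBelow t (g ∘ suc)
                sumBelow-head zero    g = ℕ.+-comm 0 (g 0)
                sumBelow-head (suc t) g rewrite sumBelow-head t g = ℕ.+-assoc (g 0) _ _

  module _ (k N : ℕ) where

    completions-zero : ∀ {n} (p : Vec ℕ n) → completions k N p 0 ≡ indicator (does (good? k p))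
    completions-zero p rewrite cong-toList (p V.++ []) p (toList-++-[] p) (λ v → does (good? k v))
      with does (good? k p)
    ... | true  = refl
    ... | false = refl

    completions-suc : ∀ {n} (p : Vec ℕ n) L →
      completions k N p (suc L) ≡ Transfer.sumTo N (λ b → completions k N (p ∷ʳ b) L)
    completions-suc p L = begin
        length (filter P? (List.concat (List.map (λ a → List.map (a ∷_) (words L (oneTo N))) (oneTo N))))
      ≡⟨ length-filter-concat P? (λ a → List.map (a ∷_) (words L (oneTo N))) (oneTo N) ⟩
        sumList (List.map (λ a → length (filter P? (List.map (a ∷_) (words L (oneTo N))))) (oneTo N))
      ≡⟨ cong sumList (List.map-cong (λ a → trans (length-filter-map P? (a ∷_) (words L (oneTo N)))
            (length-filter-cong _ _ (words L (oneTo N))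
               (λ v → cong-toList _ _ (toList-++-∷ p a v) (λ u → does (good? k u))))) (oneTo N)) ⟩
        sumList (List.map (λ b → completions k N (p ∷ʳ b) L) (oneTo N))
      ≡⟨ sum-map-oneTo (λ b → completions k N (p ∷ʳ b) L) N ⟩
        Transfer.sumTo N (λ b → completions k N (p ∷ʳ b) L)
      ∎
      where open ≡-Reasoning
            P? = λ v → good? k (p V.++ v)

  countTo : ℕ → (ℕ → Bool) → ℕ
  countTo M Q = Transfer.sumTo M (indicator ∘ Q)

  sumTo-rank : ∀ M (G : ℕ → ℕ) (Q : ℕ → Bool) →
    Transfer.sumTo M (λ b → indicator (Q b) ℕ.* G (countTo b Q)) ≡ Transfer.sumTo (countTo M Q) G
  sumTo-rank zero    G Q = refl
  sumTo-rank (suc M) G Q with Q (suc M)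
  ... | true  rewrite sumTo-rank M G Q | ℕ.+-comm (countTo M Q) 1 = cong (Transfer.sumTo (countTo M Q) G +_) (ℕ.+-identityʳ _)
  ... | false rewrite sumTo-rank M G Q | ℕ.+-identityʳ (countTo M Q) = ℕ.+-identityʳ _

  countTo-cong : ∀ M {Q R : ℕ → Bool} → (∀ a → 1 ≤ a → a ≤ M → Q a ≡ R a) → countTo M Q ≡ countTo M R
  countTo-cong M Q≡R = Transfer.sumTo-cong M (λ a 1≤a a≤M → cong indicator (Q≡R a 1≤a a≤M))

  countTo-++ : ∀ M d (Q : ℕ → Bool) → (∀ a → M < a → a ≤ M + d → Q a ≡ false) → countTo (M + d) Q ≡ countTo M Q
  countTo-++ M d Q beyond =
    trans (Transfer.sumTo-++ M d (indicator ∘ Q))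
          (trans (cong (countTo M Q +_) (Transfer.sumTo-zero d _ (λ j 1≤j j≤d →
                     cong indicator (beyond (M + j) (ℕ.m<m+n M 1≤j) (ℕ.+-monoʳ-≤ M j≤d)))))
                 (ℕ.+-identityʳ _))

  sumTo-ranges : ∀ (g A : ℕ → ℕ) M y Y X r →
    (∀ b → 1 ≤ b → b ≤ M → g b ≡ A b) →
    (∀ b → M < b → b ≤ M + y → g b ≡ Y) →
    g (suc (M + y)) ≡ X →
    (∀ b → suc (M + y) < b → g b ≡ 0) →
    Transfer.sumTo (M + y + suc r) g ≡ Transfer.sumTo M A + y ℕ.* Y + X
  sumTo-ranges g A M y Y X r g≡A g≡Y g≡X g≡0 = begin
      sumTo (M + y + suc r) g
    ≡⟨ sumTo-++ (M + y) (suc r) g ⟩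
      sumTo (M + y) g + sumTo (suc r) (λ j → g (M + y + j))
    ≡⟨ cong₂ _+_ (sumTo-++ M y g) (sumTo-++ 1 r (λ j → g (M + y + j))) ⟩
      sumTo M g + sumTo y (λ j → g (M + j)) + (g (M + y + 1) + sumTo r (λ j → g (M + y + suc j)))
    ≡⟨ cong₂ _+_ (cong₂ _+_ (sumTo-cong M g≡A) young) (cong₂ _+_ new beyond) ⟩
      sumTo M A + y ℕ.* Y + (X + 0)
    ≡⟨ cong (sumTo M A + y ℕ.* Y +_) (ℕ.+-identityʳ X) ⟩
      sumTo M A + y ℕ.* Y + X
    ∎
    where
      open ≡-Reasoning
      open Transfer using (sumTo; sumTo-++; sumTo-cong; sumTo-const; sumTo-zero)
      young : sumTo y (λ j → g (M + j)) ≡ y ℕ.* Y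
      young = trans (sumTo-cong y (λ j 1≤j j≤y → g≡Y (M + j) (ℕ.m<m+n M 1≤j) (ℕ.+-monoʳ-≤ M j≤y))) (sumTo-const y Y)
      new : g (M + y + 1) ≡ X
      new = trans (cong g (ℕ.+-comm (M + y) 1)) g≡X
      beyond : sumTo r (λ j → g (M + y + suc j)) ≡ 0
      beyond = sumTo-zero r _ (λ j 1≤j _ → g≡0 _ (subst (suc (M + y) <_) (sym (ℕ.+-suc (M + y) j)) (s≤s (ℕ.m<m+n (M + y) 1≤j))))

  module Bridge (c N : ℕ) where
    open Transfer using (sumTo; walks; newBlock; newBlock-<; newBlock-≮)

    private
      k : ℕ
      k = suc (suc c)

    -- Opaque: unfolding Closed? during unification and with-abstraction is prohibitively slow.
    opaque
      alive : ∀ {n} → Vec ℕ n → ℕ → Bool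
      alive p a = not (does (Closed? c p a))

    youngCount : ∀ {n} → Vec ℕ n → ℕ
    youngCount p = numHeads p ∸ (numHeads p ∸ c)

    aliveCount : ∀ {n} → Vec ℕ n → ℕ
    aliveCount p = countTo (numHeads p ∸ c) (alive p)

    opaque
      unfolding alive
      alive-false : ∀ {n} (p : Vec ℕ n) a → Closed c p a → alive p a ≡ false
      alive-false p a closed = cong not (dec-true (Closed? c p a) closed)

      alive-true : ∀ {n} (p : Vec ℕ n) a → ¬ Closed c p a → alive p a ≡ true
      alive-true p a open-a = cong not (dec-false (Closed? c p a) open-a)

      alive-⇔ : ∀ {n n′} (p : Vec ℕ n) (q : Vec ℕ n′) a → (Closed c p a → Closed c q a) → (Closed c q a → Closed c p a) →
        alive p a ≡ alive q a
      alive-⇔ p q a to from = cong not (does-⇔ (mk⇔ to from) (Closed? c p a) (Closed? c q a))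

    completions-bad : ∀ L {n} (p : Vec ℕ n) → ¬ Good k p → completions k N p L ≡ 0
    completions-bad zero    p bad = trans (completions-zero k N p) (cong indicator (dec-false (good? k p) bad))
    completions-bad (suc L) p bad =
      trans (completions-suc k N p L)
            (Transfer.sumTo-zero N _ (λ b _ _ → completions-bad L (p ∷ʳ b) (bad ∘ Extend.Good-init k p b)))

    private
      ≤-∸-swap : ∀ {a b m} → b ≤ m → a ≤ m ∸ b → b ≤ m ∸ a
      ≤-∸-swap {a} {b} {m} b≤m a≤m∸b = ℕ.≤-trans (ℕ.≤-reflexive (sym (ℕ.m∸[m∸n]≡n b≤m))) (ℕ.∸-monoʳ-≤ m a≤m∸b)

      c-≤-m : ∀ {a m} → 1 ≤ a → a ≤ m ∸ c → c ≤ m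
      c-≤-m {a} {m} 1≤a a≤M with c ℕ.≤? m
      ... | yes c≤m = c≤m
      ... | no  c≰m = ⊥-elim (ℕ.<-irrefl refl (ℕ.≤-trans 1≤a (ℕ.≤-trans a≤M (ℕ.≤-reflexive (ℕ.m≤n⇒m∸n≡0 (ℕ.<⇒≤ (ℕ.≰⇒> c≰m)))))))

    module Step {n : ℕ} (p : Vec ℕ n) (C : Canonical p) (nc : FrontNoncrossing k p) (Lp : LabelledByHeads p) where
      open Labels p C using (Closed-bounds)
      private
        m M y s : ℕ
        m = numHeads p
        M = m ∸ c
        y = youngCount p
        s = aliveCount p

        M+y≡m : M + y ≡ m
        M+y≡m = ℕ.m+[n∸m]≡n (ℕ.m∸n≤m m c)

      young-open : ∀ b → M < b → ¬ Closed c p b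
      young-open b M<b closed with Closed-bounds c b closed
      ... | _ , b≤m , c≤m∸b = ℕ.<⇒≱ M<b (≤-∸-swap b≤m c≤m∸b)

      module _ (b : ℕ) (1≤b : 1 ≤ b) where

        alive-∷ʳ-≤ : ∀ a → ¬ b < a → alive (p ∷ʳ b) a ≡ alive p a
        alive-∷ʳ-≤ a b≮a = alive-⇔ (p ∷ʳ b) p a to (λ closed → Closed-∷ʳ c p b C Lp 1≤b a (inj₁ closed))
          where to : Closed c (p ∷ʳ b) a → Closed c p a
                to closed with Closed-∷ʳ⁻ c p b C a closed
                ... | inj₁ before         = before
                ... | inj₂ (b<a , _ , _) = ⊥-elim (b≮a b<a)

        alive-∷ʳ-> : ∀ a → b < a → a ≤ M → alive (p ∷ʳ b) a ≡ false
        alive-∷ʳ-> a b<a a≤M = alive-false (p ∷ʳ b) a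
          (Closed-∷ʳ c p b C Lp 1≤b a (inj₂ (b<a , ℕ.≤-trans a≤M (ℕ.m∸n≤m m c) , ≤-∸-swap (c-≤-m 1≤a a≤M) a≤M)))
          where 1≤a = ℕ.≤-trans 1≤b (ℕ.<⇒≤ b<a)

      module _ (L : ℕ) (IH : ∀ {n′} (q : Vec ℕ n′) → Good k q → LabelledByHeads q → n′ + L ≤ N →
                                    completions k N q L ≡ walks c L (youngCount q) (aliveCount q))
               (n+1+L≤N : suc n + L ≤ N) where
        open Extend k p using (Good-∷ʳ; Good-∷ʳ⁻; numHeads-old; numHeads-new; LabelledByHeads-∷ʳ)

        contrib : ℕ → ℕ
        contrib b = completions k N (p ∷ʳ b) L

        contrib-open : ∀ b → 1 ≤ b → b ≤ suc m → ¬ Closed c p b →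
          contrib b ≡ walks c L (youngCount (p ∷ʳ b)) (aliveCount (p ∷ʳ b))
        contrib-open b 1≤b b≤1+m open-b =
          IH (p ∷ʳ b) (Good-∷ʳ b C nc Lp 1≤b b≤1+m open-b) (LabelledByHeads-∷ʳ b C nc Lp 1≤b b≤1+m) n+1+L≤N

        contrib-closed : ∀ b → Closed c p b → contrib b ≡ 0
        contrib-closed b closed = completions-bad L (p ∷ʳ b) bad
          where bad : ¬ Good k (p ∷ʳ b)
                bad good = proj₂ (proj₂ (Good-∷ʳ⁻ b C nc Lp good)) closed

        counts-old : ∀ b → 1 ≤ b → b ≤ m → youngCount (p ∷ʳ b) ≡ y × aliveCount (p ∷ʳ b) ≡ countTo M (alive (p ∷ʳ b))
        counts-old b 1≤b b≤m rewrite numHeads-old b C nc Lp 1≤b b≤m = refl , refl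

        contrib-old : ∀ b → 1 ≤ b → b ≤ M → contrib b ≡ indicator (alive p b) ℕ.* walks c L y (countTo b (alive p))
        contrib-old b 1≤b b≤M = by-cases (Closed? c p b)
          where
            b≤m = ℕ.≤-trans b≤M (ℕ.m∸n≤m m c)
            W = walks c L y (countTo b (alive p))
            rank : countTo M (alive (p ∷ʳ b)) ≡ countTo b (alive p)
            rank = trans (cong (λ z → countTo z (alive (p ∷ʳ b))) (sym (ℕ.m+[n∸m]≡n b≤M)))
                   (trans (countTo-++ b (M ∸ b) (alive (p ∷ʳ b))
                             (λ a b<a a≤ → alive-∷ʳ-> b 1≤b a b<a (ℕ.≤-trans a≤ (ℕ.≤-reflexive (ℕ.m+[n∸m]≡n b≤M)))))
                          (countTo-cong b (λ a _ a≤b → alive-∷ʳ-≤ b 1≤b a (ℕ.≤⇒≯ a≤b))))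
            by-cases : Dec (Closed c p b) → contrib b ≡ indicator (alive p b) ℕ.* W
            by-cases (yes closed) =
              trans (contrib-closed b closed) (sym (cong (λ z → indicator z ℕ.* W) (alive-false p b closed)))
            by-cases (no open-b) =
              trans (contrib-open b 1≤b (ℕ.m≤n⇒m≤1+n b≤m) open-b)
                    (trans (cong₂ (walks c L) (proj₁ (counts-old b 1≤b b≤m)) (trans (proj₂ (counts-old b 1≤b b≤m)) rank))
                           (trans (sym (ℕ.+-identityʳ W)) (sym (cong (λ z → indicator z ℕ.* W) (alive-true p b open-b)))))

        contrib-young : ∀ b → M < b → b ≤ M + y → contrib b ≡ walks c L y s
        contrib-young b M<b b≤M+y =
          trans (contrib-open b 1≤b (ℕ.m≤n⇒m≤1+n b≤m) (young-open b M<b))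
                (cong₂ (walks c L) (proj₁ (counts-old b 1≤b b≤m))
                       (trans (proj₂ (counts-old b 1≤b b≤m))
                              (countTo-cong M (λ a _ a≤M → alive-∷ʳ-≤ b 1≤b a (λ b<a → ℕ.<⇒≱ M<b (ℕ.≤-trans (ℕ.<⇒≤ b<a) a≤M))))))
          where
            b≤m = subst (b ≤_) M+y≡m b≤M+y
            1≤b = ℕ.≤-trans (s≤s z≤n) M<b

        contrib-beyond : ∀ b → suc (M + y) < b → contrib b ≡ 0
        contrib-beyond b 1+m<b = completions-bad L (p ∷ʳ b) bad
          where bad : ¬ Good k (p ∷ʳ b)
                bad good = ℕ.<⇒≱ (subst (λ z → suc z < b) M+y≡m 1+m<b) (proj₁ (proj₂ (Good-∷ʳ⁻ b C nc Lp good)))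

        contrib-new : contrib (suc m) ≡ newBlock c (walks c L) y s
        contrib-new = trans (contrib-open (suc m) (s≤s z≤n) ℕ.≤-refl new-open) (by-cases (c ℕ.≤? m))
          where
            w = p ∷ʳ suc m
            numHeads-w : numHeads w ≡ suc m
            numHeads-w = numHeads-new (suc m) C nc Lp refl
            new-open : ¬ Closed c p (suc m)
            new-open closed = ℕ.<-irrefl refl (proj₁ (proj₂ (Closed-bounds c (suc m) closed)))
            by-cases : Dec (c ≤ m) → walks c L (youngCount w) (aliveCount w) ≡ newBlock c (walks c L) y s
            by-cases (yes c≤m) =
              trans (cong₂ (walks c L) young-eq alive-eq) (sym (newBlock-≮ c (walks c L) s (ℕ.<-irrefl y≡c)))
              where
                y≡c : y ≡ c
                y≡c = ℕ.m∸[m∸n]≡n c≤m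
                young-eq : youngCount w ≡ y
                young-eq = trans (cong (λ z → z ∸ (z ∸ c)) numHeads-w) (trans (ℕ.m∸[m∸n]≡n (ℕ.m≤n⇒m≤1+n c≤m)) (sym y≡c))
                first-young-open : ¬ Closed c w (suc M)
                first-young-open closed with Closed-∷ʳ⁻ c p (suc m) C (suc M) closed
                ... | inj₁ before with Closed-bounds c (suc M) before
                ...   | _ , 1+M≤m , c≤ = ℕ.<-irrefl refl (≤-∸-swap 1+M≤m c≤)
                first-young-open closed | inj₂ (1+m<1+M , _) =
                  ℕ.<-irrefl refl (ℕ.<-≤-trans 1+m<1+M (s≤s (ℕ.m∸n≤m m c)))
                alive-eq : aliveCount w ≡ suc s
                alive-eq = begin
                    countTo (numHeads w ∸ c) (alive w)
                  ≡⟨ cong (λ z → countTo (z ∸ c) (alive w)) numHeads-w ⟩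
                    countTo (suc m ∸ c) (alive w)
                  ≡⟨ cong (λ z → countTo z (alive w)) (ℕ.+-∸-assoc 1 c≤m) ⟩
                    countTo M (alive w) + indicator (alive w (suc M))
                  ≡⟨ cong₂ _+_ (countTo-cong M (λ a _ a≤M → alive-∷ʳ-≤ (suc m) (s≤s z≤n) a
                                   (λ 1+m<a → ℕ.<⇒≱ 1+m<a (ℕ.≤-trans a≤M (ℕ.≤-trans (ℕ.m∸n≤m m c) (ℕ.n≤1+n m))))))
                               (cong indicator (alive-true w (suc M) first-young-open)) ⟩
                    s + 1
                  ≡⟨ ℕ.+-comm s 1 ⟩
                    suc s
                  ∎
                  where open ≡-Reasoning
            by-cases (no c≰m) =
              trans (cong₂ (walks c L) young-eq alive-eq) (sym (newBlock-< c (walks c L) s (subst (_< c) (sym y≡m) m<c)))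
              where
                m<c = ℕ.≰⇒> c≰m
                M≡0 : M ≡ 0
                M≡0 = ℕ.m≤n⇒m∸n≡0 (ℕ.<⇒≤ m<c)
                y≡m : y ≡ m
                y≡m = cong (m ∸_) M≡0
                young-eq : youngCount w ≡ suc y
                young-eq = trans (cong (λ z → z ∸ (z ∸ c)) numHeads-w)
                                 (trans (cong (suc m ∸_) (ℕ.m≤n⇒m∸n≡0 m<c)) (cong suc (sym y≡m)))
                alive-eq : aliveCount w ≡ s
                alive-eq = trans (cong (λ z → countTo (z ∸ c) (alive w)) numHeads-w)
                                 (trans (cong (λ z → countTo z (alive w)) (ℕ.m≤n⇒m∸n≡0 m<c))
                                        (sym (cong (λ z → countTo z (alive p)) M≡0)))

        completions-step : completions k N p (suc L) ≡ walks c (suc L) y s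
        completions-step = begin
            completions k N p (suc L)
          ≡⟨ completions-suc k N p L ⟩
            sumTo N contrib
          ≡⟨ cong (λ z → sumTo z contrib) (sym N≡) ⟩
            sumTo (M + y + suc r) contrib
          ≡⟨ sumTo-ranges contrib (λ b → indicator (alive p b) ℕ.* walks c L y (countTo b (alive p))) M y
                          (walks c L y s) (newBlock c (walks c L) y s) r
                          contrib-old contrib-young (trans (cong contrib (cong suc M+y≡m)) contrib-new) contrib-beyond ⟩
            sumTo M (λ b → indicator (alive p b) ℕ.* walks c L y (countTo b (alive p))) + y ℕ.* walks c L y s + nb
          ≡⟨ cong (λ z → z + y ℕ.* walks c L y s + nb) (sumTo-rank M (walks c L y) (alive p)) ⟩
            sumTo s (walks c L y) + y ℕ.* walks c L y s + nb
          ≡⟨ cong (_+ nb) (ℕ.+-comm (sumTo s (walks c L y)) (y ℕ.* walks c L y s)) ⟩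
            y ℕ.* walks c L y s + sumTo s (walks c L y) + nb
          ∎
          where
            open ≡-Reasoning
            r = N ∸ suc m
            nb = newBlock c (walks c L) y s
            N≡ : M + y + suc r ≡ N
            N≡ = trans (cong (_+ suc r) M+y≡m) (trans (ℕ.+-suc m r) (ℕ.m+[n∸m]≡n 1+m≤N))
              where 1+m≤N = ℕ.≤-trans (s≤s (count-≤ n _)) (ℕ.≤-trans (ℕ.m≤m+n (suc n) L) n+1+L≤N)

    bridge : ∀ L {n} (p : Vec ℕ n) → Good k p → LabelledByHeads p → n + L ≤ N →
      completions k N p L ≡ walks c L (youngCount p) (aliveCount p)
    bridge zero    p good _ _ = trans (completions-zero k N p) (cong indicator (dec-true (good? k p) good))
    bridge (suc L) {n} p (C , nc) Lp n+1+L≤N =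
      Step.completions-step p C nc Lp L (λ q → bridge L q) (subst (_≤ N) (ℕ.+-suc n L) n+1+L≤N)

  f≡walks : ∀ c t → f (suc (suc c)) t ≡ Transfer.walks c t 0 0
  f≡walks c t = trans (Bridge.bridge c t t [] empty-good empty-labelled ℕ.≤-refl) (cong₂ (Transfer.walks c t) young alive)
    where
      empty-good : Good (suc (suc c)) []
      empty-good = (λ ()) , λ { (() , _) }
      empty-labelled : LabelledByHeads []
      empty-labelled = (λ ()) , λ { (suc ℓ) (s≤s z≤n) () }
      young : Bridge.youngCount c t [] ≡ 0
      young rewrite ℕ.0∸n≡0 c = refl
      alive : Bridge.aliveCount c t [] ≡ 0
      alive rewrite ℕ.0∸n≡0 c = refl

open import Defs
open import Data.Nat using (ℕ; _≤_; _∸_; _+_; suc; s≤s; z≤n)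
open import Data.Integer using (ℤ; +_; _-_; _*_) renaming (_+_ to _⊕_)
open import Data.Product using (_×_; _,_)
open import Relation.Binary.PropositionalEquality using (_≡_; trans)

theorem1p1 : (k : ℕ) → 2 ≤ k →
    (f k 0 ≡ 1) × (f k 1 ≡ 1) ×
    ((n : ℕ) → 2 ≤ n →
      + f k n ≡
        ((+ (k ∸ 1)) * (+ f k (n ∸ 1))
        ⊕ sumZ 1 (k ∸ 3) (λ i → ((+ (i + 2)) - (+ k)) * (+ S (n ∸ 1) i)))
        ⊕ sumZ (k ∸ 2) (n ∸ 2) (λ i →
            ((+ f k i) - sumZ 1 (k ∸ 3) (λ j → + S i j))
            * sumZ 1 (k ∸ 1) (λ r → s (k ∸ 1) r * (+ f k ((n ∸ 2 ∸ i) + r)))))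
theorem1p1 (suc (suc c)) (s≤s (s≤s z≤n)) =
  f≡walks c 0 ,
  trans (f≡walks c 1) (Transfer.newBlock-const c 1 0 0) ,
  λ { (suc (suc m)) (s≤s (s≤s z≤n)) → Differences.walks-recurrence c (f (suc (suc c))) (f≡walks c) m }
  where open Words using (f≡walks)
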